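{- (1) $\mathrm{Pr}(\mathrm{Fig}(T^\phi)\setminus\{T\})$ is the set of points of $m_T$ not in $\mathcal S_1\cup\{T^{\phi}\}$. (2) $\mathrm{Pr}(\mathrm{Fig}(T^{\phi^2})\setminus\{T\})$ is the set of points of $m_T$ not in $\mathcal S_1\cup\{T^{\phi^2}\}$.
   Context: Let $q$ be a prime power, $\mathbb{F}_{q^3}^*=\mathbb{F}_{q^3}\setminus\{0\}$. Points of $\mathrm{PG}(2,q^3)$ have coordinates $(x,y,z)$, lines $[a,b,c]$, incidence iff $ax+by+cz=0$. Let $\phi$ be the collineation $(x,y,z)\mapsto(z^q,x^q,y^q)$ (on lines $[d,e,f]\mapsto[f^q,d^q,e^q]$). A point has Type I, II, III according as its $\phi$-orbit is one point, three collinear points, three non-collinear points; a line has Type I, II, III according as its $\phi$-orbit is one line, three concurrent lines, three non-concurrent lines. For a Type III point $P$ let $\mu(P)=P^\phi P^{\phi^2}$, and for a Type III line $\ell$ let $\mu(\ell)=\ell^\phi\cap\ell^{\phi^2}$. For a Type III point $U$, the Fig-block $\mathrm{Fig}(U)$ is the point set consisting of the Type II points on the line $\mu(U)$ together with $\{\mu(\ell):\ell\text{ a Type III line through }U\}$. Let $T=(0,0,1)$, $T^\phi=(1,0,0)$, $T^{\phi^2}=(0,1,0)$ (all Type III), $m_T=[0,0,1]=T^\phi T^{\phi^2}$. Let $\mathcal S_1=\{(x,x^q,0):x\in\mathbb{F}_{q^3}^*\}\subset m_T$. For a point set $\mathcal B$ not containing $T$, $\mathrm{Pr}(\mathcal B)=\{TP\cap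 m_T:P\in\mathcal B\}$. -}

module Defs where

open import Level using (Level; _⊔_)
open import Data.Nat as ℕ using (ℕ; _≤_)
open import Data.Nat.Primality using (Prime)
open import Data.Fin using (Fin)
open import Data.Product using (Σ; ∃; ∃-syntax; _×_; _,_)
open import Data.Sum using (_⊎_)
open import Relation.Nullary using (¬_)
open import Relation.Binary.PropositionalEquality using (_≡_)
open import Function.Bundles using (_⇔_)
open import Algebra.Bundles using (CommutativeRing; Semiring)

IsPrimePower : ℕ → Set
IsPrimePower q = ∃[ p ] ∃[ k ] (Prime p × 1 ≤ k × q ≡ p ℕ.^ k)

module _ {c ℓ : Level} (R : CommutativeRing c ℓ) where
  open CommutativeRing R

  IsField : Set (c ⊔ ℓ)
  IsField = (¬ (0# ≈ 1#)) × (∀ x → ¬ (x ≈ 0#) → ∃[ y ] (x * y ≈ 1#))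

  HasSize : ℕ → Set (c ⊔ ℓ)
  HasSize n = Σ (Fin n → Carrier) λ e → ((∀ (i j : Fin n) → e i ≈ e j → i ≡ j) × (∀ x → ∃[ i ] (e i ≈ x)))

-- Projective plane PG(2,F) over the field F = R, with the collineation φ
-- built from the map x ↦ x^q.
module PG {c ℓ : Level} (R : CommutativeRing c ℓ) (q : ℕ) where
  open CommutativeRing R
  open import Algebra.Definitions.RawSemiring (Semiring.rawSemiring semiring) using (_^_)

  -- coordinate triples, used both for points (x,y,z) and lines [a,b,c]
  record V3 : Set c where
    constructor ⟨_,_,_⟩
    field
      x₁ x₂ x₃ : Carrier
  open V3 public

  -- a triple represents a point/line iff it is nonzero
  NZ : V3 → Set ℓ
  NZ v = ¬ ((x₁ v ≈ 0#) × (x₂ v ≈ 0#) × (x₃ v ≈ 0#))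

  -- equality of projective points/lines: proportional by a nonzero scalar
  _∼_ : V3 → V3 → Set (c ⊔ ℓ)
  u ∼ v = ∃[ k ] ((¬ (k ≈ 0#)) × (x₁ u ≈ k * x₁ v) × (x₂ u ≈ k * x₂ v) × (x₃ u ≈ k * x₃ v))

  Inc : V3 → V3 → Set ℓ
  Inc P L = (x₁ L * x₁ P + x₂ L * x₂ P + x₃ L * x₃ P) ≈ 0#

  -- φ : (x,y,z) ↦ (z^q, x^q, y^q); on lines [d,e,f] ↦ [f^q, d^q, e^q] (same formula)
  φ : V3 → V3
  φ v = ⟨ x₃ v ^ q , x₁ v ^ q , x₂ v ^ q ⟩

  φ² : V3 → V3
  φ² v = φ (φ v)

  Collinear : V3 → V3 → V3 → Set (c ⊔ ℓ)
  Collinear A B C = ∃[ L ] (NZ L × Inc A L × Inc B L × Inc C L)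

  Concurrent : V3 → V3 → V3 → Set (c ⊔ ℓ)
  Concurrent l m n = ∃[ P ] (NZ P × Inc P l × Inc P m × Inc P n)

  TypeIPt : V3 → Set (c ⊔ ℓ)
  TypeIPt P = P ∼ φ P

  TypeIIPt : V3 → Set (c ⊔ ℓ)
  TypeIIPt P = (¬ TypeIPt P) × Collinear P (φ P) (φ² P)

  TypeIIIPt : V3 → Set (c ⊔ ℓ)
  TypeIIIPt P = ¬ Collinear P (φ P) (φ² P)

  TypeIIILine : V3 → Set (c ⊔ ℓ)
  TypeIIILine l = ¬ Concurrent l (φ l) (φ² l)

  OnMu : V3 → V3 → Set (c ⊔ ℓ)
  OnMu U X = ∃[ L ] (NZ L × Inc (φ U) L × Inc (φ² U) L × Inc X L)

  Fig : V3 → V3 → Set (c ⊔ ℓ)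
  Fig U X = (TypeIIPt X × OnMu U X)
          ⊎ (∃[ l ] (NZ l × TypeIIILine l × Inc U l × Inc X (φ l) × Inc X (φ² l)))

  T : V3
  T = ⟨ 0# , 0# , 1# ⟩

  mT : V3
  mT = ⟨ 0# , 0# , 1# ⟩

  FigMinusT : V3 → V3 → Set (c ⊔ ℓ)
  FigMinusT U X = Fig U X × ¬ (X ∼ T)

  Pr : (V3 → Set (c ⊔ ℓ)) → V3 → Set (c ⊔ ℓ)
  Pr B X = ∃[ P ] (NZ P × B P × Inc X mT
                    × ∃[ L ] (NZ L × Inc T L × Inc P L × Inc X L))

  S₁ : V3 → Set (c ⊔ ℓ)
  S₁ X = ∃[ a ] ((¬ (a ≈ 0#)) × X ∼ ⟨ a , a ^ q , 0# ⟩)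

  Part1 : Set (c ⊔ ℓ)
  Part1 = ∀ X → NZ X →
    (Pr (FigMinusT (φ T)) X ⇔ (Inc X mT × ¬ S₁ X × ¬ (X ∼ φ T)))

  Part2 : Set (c ⊔ ℓ)
  Part2 = ∀ X → NZ X →
    (Pr (FigMinusT (φ² T)) X ⇔ (Inc X mT × ¬ S₁ X × ¬ (X ∼ φ² T)))

{-# OPTIONS --safe #-}
-- Write σ x = x ^ q and norm x = x · σ x · σ² x. In the field F with q³ elements σ is an
-- automorphism of order 3: it is additive because F has characteristic p (binomial theorem),
-- and σ³ x = x ^ q³ = x (Fermat, by permuting the factors of a product over F).
--
-- A point P ≠ T projects from T to (x₁, x₂, 0) when its first two coordinates are
-- proportional to (x₁, x₂). For a Type III line l through T^φ (resp. T^φ²), the line φ² l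
-- (resp. φ l) passes through T, hence is the line T μ(l) and contains the projection X of μ(l).
-- If X ∈ S₁, say X ∼ (a, σ a, 0), then the φ-fixed point (a, σ a, σ² a) lies on that line, so on
-- l, φ l and φ² l alike, contradicting Type III; and X = T^φ (resp. T^φ²) would force l = m_T,
-- whose μ is T. Type II points of μ(T^φ) (resp. μ(T^φ²)) lie on the line through T and T^φ²
-- (resp. T^φ) and project to that point.
--
-- Conversely, by Hilbert 90 a point X = (x₁, x₂, 0) is in S₁ exactly when norm x₁ = norm x₂.
-- Otherwise the line l through T^φ (resp. T^φ²) with φ² l = TX (resp. φ l = TX) has
-- det (l, φ l, φ² l) = norm x₂ - norm x₁ ≠ 0, so it is of Type III, and μ(l) projects to X.

module Submission where

open import Level using (Level; 0ℓ)
open import Algebra.Bundles using (CommutativeRing; RawRing)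
open import Data.Nat as ℕ using (ℕ; zero; suc; _≤_; _<_; s≤s; z≤n)
import Data.Nat.Properties as ℕ
open import Data.Nat.Primality using (Prime; ¬prime[0]; prime⇒nonTrivial)
open import Data.Fin as Fin using (Fin)
import Data.Fin.Properties as Fin
open import Data.Fin.Permutation using (Permutation; permutation)
open import Data.List using (List; []; _∷_; length)
open import Data.List.Relation.Unary.All using (All; []; _∷_)
open import Data.Vec.Functional using (Vector; tail; replicate)
open import Data.Product using (∃-syntax; _×_; _,_; proj₁; proj₂)
open import Data.Sum using (inj₁; inj₂)
open import Data.Empty using (⊥; ⊥-elim)
open import Function using (_∘_)
open import Function.Bundles using (mk⇔)
open import Relation.Nullary using (¬_; yes; no; contradiction)
open import Relation.Binary.Definitions using (Decidable)
open import Relation.Binary.PropositionalEquality as ≡ using (_≡_; _≢_)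
open import Defs

-- The library's ring solver needs a coefficient ring whose equality computes; the integers,
-- mapped into R by n ↦ n · 1#, serve for every commutative ring.
module IntegerCoefficientSolver {c ℓ} (R : CommutativeRing c ℓ) where
  open CommutativeRing R
  open import Data.Integer as ℤ using (ℤ; +_; -[1+_])
  open import Data.Maybe using (Maybe; just; nothing)
  open import Algebra.Properties.Ring ring using (-‿involutive; -0#≈0#; -‿distribˡ-*; -‿distribʳ-*; -‿+-comm)
  open import Algebra.Properties.CommutativeSemigroup +-commutativeSemigroup using (interchange)
  open import Algebra.Properties.Semiring.Mult semiring using (×-homo-+; ×1-homo-*) renaming (_×_ to _·_)
  open import Algebra.Solver.Ring.AlmostCommutativeRing
  import Data.Integer.Properties as ℤ
  open import Data.Sign as Sign using (Sign)
  open import Relation.Binary.Reasoning.Setoid setoid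

  ℤ-rawRing : RawRing 0ℓ 0ℓ
  ℤ-rawRing = record
    { Carrier = ℤ ; _≈_ = _≡_ ; _+_ = ℤ._+_ ; _*_ = ℤ._*_ ; -_ = ℤ.-_ ; 0# = + 0 ; 1# = + 1 }

  fromℤ : ℤ → Carrier
  fromℤ (+ n) = n · 1#
  fromℤ -[1+ n ] = - (suc n · 1#)

  signed : Sign → Carrier → Carrier
  signed Sign.+ x = x
  signed Sign.- x = - x

  signed-cong : ∀ s {x y} → x ≈ y → signed s x ≈ signed s y
  signed-cong Sign.+ x≈y = x≈y
  signed-cong Sign.- x≈y = -‿cong x≈y

  signed-* : ∀ s t x y → signed (s Sign.* t) (x * y) ≈ signed s x * signed t y
  signed-* Sign.+ Sign.+ x y = refl
  signed-* Sign.+ Sign.- x y = -‿distribʳ-* x y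
  signed-* Sign.- Sign.+ x y = -‿distribˡ-* x y
  signed-* Sign.- Sign.- x y = begin
    x * y          ≈⟨ -‿involutive (x * y) ⟨
    - (- (x * y))  ≈⟨ -‿cong (-‿distribʳ-* x y) ⟩
    - (x * - y)    ≈⟨ -‿distribˡ-* x (- y) ⟩
    - x * - y      ∎

  fromℤ-◃ : ∀ s n → fromℤ (s ℤ.◃ n) ≈ signed s (n · 1#)
  fromℤ-◃ Sign.+ zero = refl
  fromℤ-◃ Sign.- zero = sym -0#≈0#
  fromℤ-◃ Sign.+ (suc n) = refl
  fromℤ-◃ Sign.- (suc n) = refl

  fromℤ-signed : ∀ i → fromℤ i ≈ signed (ℤ.sign i) (ℤ.∣ i ∣ · 1#)
  fromℤ-signed (+ n) = refl
  fromℤ-signed -[1+ n ] = refl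

  fromℤ-homo-* : ∀ i j → fromℤ (i ℤ.* j) ≈ fromℤ i * fromℤ j
  fromℤ-homo-* i j = begin
    fromℤ (i ℤ.* j)                            ≈⟨ fromℤ-◃ s (ℤ.∣ i ∣ ℕ.* ℤ.∣ j ∣) ⟩
    signed s ((ℤ.∣ i ∣ ℕ.* ℤ.∣ j ∣) · 1#)       ≈⟨ signed-cong s (×1-homo-* ℤ.∣ i ∣ ℤ.∣ j ∣) ⟩
    signed s ((ℤ.∣ i ∣ · 1#) * (ℤ.∣ j ∣ · 1#))  ≈⟨ signed-* (ℤ.sign i) (ℤ.sign j) _ _ ⟩
    signed (ℤ.sign i) (ℤ.∣ i ∣ · 1#) * signed (ℤ.sign j) (ℤ.∣ j ∣ · 1#)
                                               ≈⟨ *-cong (fromℤ-signed i) (fromℤ-signed j) ⟨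
    fromℤ i * fromℤ j                          ∎
    where s = ℤ.sign i Sign.* ℤ.sign j

  1+x-[1+y]≈x-y : ∀ x y → (1# + x) - (1# + y) ≈ x - y
  1+x-[1+y]≈x-y x y = begin
    (1# + x) - (1# + y)      ≈⟨ +-congˡ (-‿+-comm 1# y) ⟨
    (1# + x) + (- 1# - y)    ≈⟨ interchange 1# x (- 1#) (- y) ⟩
    (1# - 1#) + (x - y)      ≈⟨ +-congʳ (-‿inverseʳ 1#) ⟩
    0# + (x - y)             ≈⟨ +-identityˡ (x - y) ⟩
    x - y                    ∎

  fromℤ-⊖ : ∀ m n → fromℤ (m ℤ.⊖ n) ≈ m · 1# - n · 1#
  fromℤ-⊖ zero zero = sym (-‿inverseʳ 0#)
  fromℤ-⊖ (suc m) zero = sym (trans (+-congˡ -0#≈0#) (+-identityʳ _))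
  fromℤ-⊖ zero (suc n) = sym (+-identityˡ _)
  fromℤ-⊖ (suc m) (suc n) = begin
    fromℤ (suc m ℤ.⊖ suc n)  ≡⟨ ≡.cong fromℤ (ℤ.[1+m]⊖[1+n]≡m⊖n m n) ⟩
    fromℤ (m ℤ.⊖ n)          ≈⟨ fromℤ-⊖ m n ⟩
    m · 1# - n · 1#          ≈⟨ 1+x-[1+y]≈x-y _ _ ⟨
    suc m · 1# - suc n · 1#  ∎

  fromℤ-homo-+ : ∀ i j → fromℤ (i ℤ.+ j) ≈ fromℤ i + fromℤ j
  fromℤ-homo-+ (+ m) (+ n) = ×-homo-+ 1# m n
  fromℤ-homo-+ (+ m) -[1+ n ] = fromℤ-⊖ m (suc n)
  fromℤ-homo-+ -[1+ m ] (+ n) = trans (fromℤ-⊖ n (suc m)) (+-comm _ _)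
  fromℤ-homo-+ -[1+ m ] -[1+ n ] = begin
    - (suc (suc (m ℕ.+ n)) · 1#)       ≡⟨ ≡.cong (λ k → - (k · 1#)) (ℕ.+-suc (suc m) n) ⟨
    - ((suc m ℕ.+ suc n) · 1#)         ≈⟨ -‿cong (×-homo-+ 1# (suc m) (suc n)) ⟩
    - (suc m · 1# + suc n · 1#)        ≈⟨ -‿+-comm _ _ ⟨
    - (suc m · 1#) + - (suc n · 1#)    ∎

  fromℤ-homo-neg : ∀ i → fromℤ (ℤ.- i) ≈ - fromℤ i
  fromℤ-homo-neg (+ zero) = sym -0#≈0#
  fromℤ-homo-neg (+ suc n) = refl
  fromℤ-homo-neg -[1+ n ] = sym (-‿involutive _)

  ℤ⟶R : ℤ-rawRing -Raw-AlmostCommutative⟶ fromCommutativeRing R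
  ℤ⟶R = record
    { ⟦_⟧ = fromℤ ; +-homo = fromℤ-homo-+ ; *-homo = fromℤ-homo-* ; -‿homo = fromℤ-homo-neg
    ; 0-homo = refl ; 1-homo = +-identityʳ 1# }

  fromℤ-≟ : ∀ i j → Maybe (fromℤ i ≈ fromℤ j)
  fromℤ-≟ i j with i ℤ.≟ j
  ... | yes ≡.refl = just refl
  ... | no _ = nothing

  open import Algebra.Solver.Ring ℤ-rawRing (fromCommutativeRing R) ℤ⟶R fromℤ-≟ public

  :0 : ∀ {n} → Polynomial n
  :0 = con (+ 0)

module PrimeBinomial where
  open import Data.Nat using (_∸_; _*_; _!)
  open import Data.Nat.Properties
  open import Data.Nat.Divisibility
  open import Data.Nat.DivMod using (m/n*n≡m)
  open import Data.Nat.Primality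
  open import Data.Nat.Combinatorics using (_C_; nCk≡n!/k![n-k]!; k![n∸k]!∣n!)

  p∤m! : ∀ {p} → Prime p → ∀ {m} → m < p → ¬ (p ∣ m !)
  p∤m! p-prime {zero} _ p∣1 = ¬prime[1] (≡.subst Prime (∣1⇒≡1 p∣1) p-prime)
  p∤m! p-prime {suc m} m<p p∣m! with euclidsLemma (suc m) (m !) p-prime p∣m!
  ... | inj₁ p∣1+m = <⇒≱ m<p (∣⇒≤ p∣1+m)
  ... | inj₂ p∣m!′ = p∤m! p-prime (<-trans (n<1+n m) m<p) p∣m!′

  n∣n! : ∀ {n} → 0 < n → n ∣ n !
  n∣n! {suc n} _ = m∣m*n (n !)

  -- p! = (p C k) · k! · (p ∸ k)!, and p divides neither factorial.
  p∣pCk : ∀ {p k} → Prime p → 0 < k → k < p → p ∣ p C k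
  p∣pCk {p} {k} p-prime 0<k k<p with euclidsLemma (p C k) (k ! * (p ∸ k) !) p-prime p∣product
    where
    instance _ = k !* (p ∸ k) !≢0
    p∣product : p ∣ (p C k) * (k ! * (p ∸ k) !)
    p∣product = ≡.subst (p ∣_)
      (≡.sym (≡.trans (≡.cong (_* (k ! * (p ∸ k) !)) (nCk≡n!/k![n-k]! (<⇒≤ k<p)))
                      (m/n*n≡m (k![n∸k]!∣n! (<⇒≤ k<p)))))
      (n∣n! (<-trans 0<k k<p))
  ... | inj₁ p∣pCk = p∣pCk
  ... | inj₂ p∣k![p∸k]! with euclidsLemma (k !) ((p ∸ k) !) p-prime p∣k![p∸k]!
  ...   | inj₁ p∣k! = ⊥-elim (p∤m! p-prime k<p p∣k!)
  ...   | inj₂ p∣[p∸k]! = ⊥-elim (p∤m! p-prime (∸-monoʳ-< 0<k (<⇒≤ k<p)) p∣[p∸k]!)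

module Field {c ℓ} (R : CommutativeRing c ℓ) (isField : IsField R) where
  open CommutativeRing R
  open import Algebra.Properties.Ring ring using (-‿distribʳ-*; x∙y⁻¹≈ε⇒x≈y; x≈y⇒x∙y⁻¹≈ε)
  open import Algebra.Properties.CommutativeSemiring.Exp commutativeSemiring using (_^_)
  open import Relation.Binary.Reasoning.Setoid setoid

  1≉0 : 1# ≉ 0#
  1≉0 1≈0 = proj₁ isField (sym 1≈0)

  inverse : ∀ x → x ≉ 0# → ∃[ y ] (x * y ≈ 1#)
  inverse = proj₂ isField

  x*y≈0⇒y≈0 : ∀ {x y} → x ≉ 0# → x * y ≈ 0# → y ≈ 0#
  x*y≈0⇒y≈0 {x} {y} x≉0 xy≈0 = let (x⁻¹ , xx⁻¹≈1) = inverse x x≉0 in begin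
    y               ≈⟨ *-identityˡ y ⟨
    1# * y          ≈⟨ *-congʳ xx⁻¹≈1 ⟨
    (x * x⁻¹) * y   ≈⟨ *-congʳ (*-comm x x⁻¹) ⟩
    (x⁻¹ * x) * y   ≈⟨ *-assoc x⁻¹ x y ⟩
    x⁻¹ * (x * y)   ≈⟨ *-congˡ xy≈0 ⟩
    x⁻¹ * 0#        ≈⟨ zeroʳ x⁻¹ ⟩
    0#              ∎

  x*y≈0⇒x≈0 : ∀ {x y} → y ≉ 0# → x * y ≈ 0# → x ≈ 0#
  x*y≈0⇒x≈0 y≉0 xy≈0 = x*y≈0⇒y≈0 y≉0 (trans (*-comm _ _) xy≈0)

  x*y≉0 : ∀ {x y} → x ≉ 0# → y ≉ 0# → x * y ≉ 0#
  x*y≉0 x≉0 y≉0 xy≈0 = y≉0 (x*y≈0⇒y≈0 x≉0 xy≈0)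

  x^n≉0 : ∀ {x} n → x ≉ 0# → x ^ n ≉ 0#
  x^n≉0 zero x≉0 = 1≉0
  x^n≉0 (suc n) x≉0 = x*y≉0 x≉0 (x^n≉0 n x≉0)

  *-cancelˡ : ∀ {x y z} → x ≉ 0# → x * y ≈ x * z → y ≈ z
  *-cancelˡ {x} {y} {z} x≉0 xy≈xz = x∙y⁻¹≈ε⇒x≈y y z (x*y≈0⇒y≈0 x≉0 (begin
    x * (y - z)        ≈⟨ distribˡ x y (- z) ⟩
    x * y + x * - z    ≈⟨ +-congˡ (-‿distribʳ-* x z) ⟨
    x * y - x * z      ≈⟨ x≈y⇒x∙y⁻¹≈ε xy≈xz ⟩
    0#                 ∎))

module Polynomial {c ℓ} (R : CommutativeRing c ℓ) (isField : IsField R) where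
  open CommutativeRing R
  open Field R isField
  open import Algebra.Properties.Ring ring using (x∙y⁻¹≈ε⇒x≈y)
  open import Algebra.Properties.CommutativeSemiring.Exp commutativeSemiring using (_^_)
  open IntegerCoefficientSolver R using (solve; _:+_; _:*_; _:-_; _:=_)
  open import Algebra.Properties.CommutativeSemigroup *-commutativeSemigroup using (x∙yz≈y∙xz)
  open import Relation.Binary.Reasoning.Setoid setoid

  eval : List Carrier → Carrier → Carrier
  eval [] y = 0#
  eval (a ∷ as) y = a + y * eval as y

  quotientBy : Carrier → List Carrier → List Carrier
  quotientBy r [] = []
  quotientBy r (a ∷ as) = eval (a ∷ as) r ∷ quotientBy r as

  length-quotientBy : ∀ r as → length (quotientBy r as) ≡ length as
  length-quotientBy r [] = ≡.refl
  length-quotientBy r (a ∷ as) = ≡.cong suc (length-quotientBy r as)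

  private
    division-base : ∀ a y r z → a + y * z ≈ (y - r) * z + (a + r * z)
    division-base = solve 4 (λ a y r z → a :+ y :* z := (y :- r) :* z :+ (a :+ r :* z)) refl

    division-step : ∀ a y r g b → a + y * ((y - r) * g + b) ≈ (y - r) * (b + y * g) + (a + r * b)
    division-step = solve 5 (λ a y r g b →
      a :+ y :* ((y :- r) :* g :+ b) := (y :- r) :* (b :+ y :* g) :+ (a :+ r :* b)) refl

  eval-division : ∀ a as y r → eval (a ∷ as) y ≈ (y - r) * eval (quotientBy r as) y + eval (a ∷ as) r
  eval-division a [] y r = division-base a y r 0#
  eval-division a (b ∷ bs) y r = begin
    a + y * eval (b ∷ bs) y
      ≈⟨ +-congˡ (*-congˡ (eval-division b bs y r)) ⟩
    a + y * ((y - r) * eval (quotientBy r bs) y + eval (b ∷ bs) r)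
      ≈⟨ division-step a y r _ _ ⟩
    (y - r) * (eval (b ∷ bs) r + y * eval (quotientBy r bs) y) + (a + r * eval (b ∷ bs) r) ∎

  eval-vanishing : ∀ as y → All (_≈ 0#) as → eval as y ≈ 0#
  eval-vanishing [] y [] = refl
  eval-vanishing (a ∷ as) y (a≈0 ∷ as≈0) = begin
    a + y * eval as y  ≈⟨ +-cong a≈0 (*-congˡ (eval-vanishing as y as≈0)) ⟩
    0# + y * 0#        ≈⟨ +-identityˡ _ ⟩
    y * 0#             ≈⟨ zeroʳ y ⟩
    0#                 ∎

  head-vanishing : ∀ a as r → eval (a ∷ as) r ≈ 0# → eval as r ≈ 0# → a ≈ 0#
  head-vanishing a as r root as-root = begin
    a                  ≈⟨ +-identityʳ a ⟨
    a + 0#             ≈⟨ +-congˡ (trans (*-congˡ as-root) (zeroʳ r)) ⟨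
    a + r * eval as r  ≈⟨ root ⟩
    0#                 ∎

  quotientBy-vanishing : ∀ r as → All (_≈ 0#) (quotientBy r as) → All (_≈ 0#) as
  quotientBy-vanishing r [] [] = []
  quotientBy-vanishing r (a ∷ as) (root ∷ quotient≈0) =
    head-vanishing a as r root (eval-vanishing as r as≈0) ∷ as≈0
    where as≈0 = quotientBy-vanishing r as quotient≈0

  rootBound : ∀ {m} as (r : Fin m → Carrier) → (∀ i j → r i ≈ r j → i ≡ j) →
              length as ≤ m → (∀ i → eval as (r i) ≈ 0#) → All (_≈ 0#) as
  rootBound [] r r-injective _ _ = []
  rootBound {suc m} (a ∷ as) r r-injective (s≤s |as|≤m) roots =
    head-vanishing a as r₀ (roots Fin.zero) (eval-vanishing as r₀ as≈0) ∷ as≈0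
    where
    r₀ = r Fin.zero

    quotient-roots : ∀ i → eval (quotientBy r₀ as) (r (Fin.suc i)) ≈ 0#
    quotient-roots i = x*y≈0⇒y≈0 (λ rᵢ-r₀≈0 → Fin.0≢1+n (r-injective _ _ (sym (x∙y⁻¹≈ε⇒x≈y _ _ rᵢ-r₀≈0))))
      (begin
        (rᵢ - r₀) * eval (quotientBy r₀ as) rᵢ                        ≈⟨ +-identityʳ _ ⟨
        (rᵢ - r₀) * eval (quotientBy r₀ as) rᵢ + 0#                   ≈⟨ +-congˡ (roots Fin.zero) ⟨
        (rᵢ - r₀) * eval (quotientBy r₀ as) rᵢ + eval (a ∷ as) r₀     ≈⟨ eval-division a as rᵢ r₀ ⟨
        eval (a ∷ as) rᵢ                                             ≈⟨ roots (Fin.suc i) ⟩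
        0#                                                           ∎)
      where rᵢ = r (Fin.suc i)

    as≈0 : All (_≈ 0#) as
    as≈0 = quotientBy-vanishing r₀ as
      (rootBound (quotientBy r₀ as) (λ i → r (Fin.suc i)) (λ i j rᵢ≈rⱼ → Fin.suc-injective (r-injective _ _ rᵢ≈rⱼ))
        (≡.subst (_≤ m) (≡.sym (length-quotientBy r₀ as)) |as|≤m) quotient-roots)

  monomial : Carrier → ℕ → List Carrier
  monomial a zero = a ∷ []
  monomial a (suc k) = 0# ∷ monomial a k

  length-monomial : ∀ a k → length (monomial a k) ≡ suc k
  length-monomial a zero = ≡.refl
  length-monomial a (suc k) = ≡.cong suc (length-monomial a k)

  eval-monomial : ∀ a k y → eval (monomial a k) y ≈ a * y ^ k
  eval-monomial a zero y = begin
    a + y * 0#  ≈⟨ +-congˡ (zeroʳ y) ⟩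
    a + 0#      ≈⟨ +-identityʳ a ⟩
    a           ≈⟨ *-identityʳ a ⟨
    a * 1#      ∎
  eval-monomial a (suc k) y = begin
    0# + y * eval (monomial a k) y  ≈⟨ +-identityˡ _ ⟩
    y * eval (monomial a k) y       ≈⟨ *-congˡ (eval-monomial a k y) ⟩
    y * (a * y ^ k)                 ≈⟨ x∙yz≈y∙xz y a (y ^ k) ⟩
    a * (y * y ^ k)                 ∎

  infixl 6 _⊕_
  _⊕_ : List Carrier → List Carrier → List Carrier
  [] ⊕ bs = bs
  (a ∷ as) ⊕ [] = a ∷ as
  (a ∷ as) ⊕ (b ∷ bs) = a + b ∷ as ⊕ bs

  eval-⊕ : ∀ as bs y → eval (as ⊕ bs) y ≈ eval as y + eval bs y
  eval-⊕ [] bs y = sym (+-identityˡ _)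
  eval-⊕ (a ∷ as) [] y = sym (+-identityʳ _)
  eval-⊕ (a ∷ as) (b ∷ bs) y = begin
    (a + b) + y * eval (as ⊕ bs) y                 ≈⟨ +-congˡ (*-congˡ (eval-⊕ as bs y)) ⟩
    (a + b) + y * (eval as y + eval bs y)          ≈⟨ rearrange a b y _ _ ⟩
    (a + y * eval as y) + (b + y * eval bs y)      ∎
    where
    rearrange : ∀ a b y u v → (a + b) + y * (u + v) ≈ (a + y * u) + (b + y * v)
    rearrange = solve 5 (λ a b y u v → (a :+ b) :+ y :* (u :+ v) := (a :+ y :* u) :+ (b :+ y :* v)) refl

  length-⊕ : ∀ {k} as bs → length as ≤ k → length bs ≤ k → length (as ⊕ bs) ≤ k
  length-⊕ [] bs _ |bs|≤k = |bs|≤k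
  length-⊕ (a ∷ as) [] |as|≤k _ = |as|≤k
  length-⊕ (a ∷ as) (b ∷ bs) (s≤s |as|≤k) (s≤s |bs|≤k) = s≤s (length-⊕ as bs |as|≤k |bs|≤k)

  trinomial : Carrier → Carrier → ℕ → ℕ → List Carrier
  trinomial a b m n = 0# ∷ 1# ∷ monomial a m ⊕ monomial b n

  length-trinomial : ∀ a b m n → length (trinomial a b m n) ≤ suc (suc (suc m ℕ.⊔ suc n))
  length-trinomial a b m n = s≤s (s≤s (length-⊕ (monomial a m) (monomial b n)
    (ℕ.≤-trans (ℕ.≤-reflexive (length-monomial a m)) (ℕ.m≤m⊔n (suc m) (suc n)))
    (ℕ.≤-trans (ℕ.≤-reflexive (length-monomial b n)) (ℕ.m≤n⊔m (suc m) (suc n)))))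

  eval-trinomial : ∀ a b m n y → eval (trinomial a b m n) y ≈ y + a * y ^ suc (suc m) + b * y ^ suc (suc n)
  eval-trinomial a b m n y = begin
    0# + y * (1# + y * eval (monomial a m ⊕ monomial b n) y)
      ≈⟨ +-identityˡ _ ⟩
    y * (1# + y * eval (monomial a m ⊕ monomial b n) y)
      ≈⟨ *-congˡ (+-congˡ (*-congˡ (trans (eval-⊕ (monomial a m) (monomial b n) y)
                                          (+-cong (eval-monomial a m y) (eval-monomial b n y))))) ⟩
    y * (1# + y * (a * y ^ m + b * y ^ n))
      ≈⟨ expand y 1# a b (y ^ m) (y ^ n) ⟩
    y * 1# + a * (y * (y * y ^ m)) + b * (y * (y * y ^ n))
      ≈⟨ +-congʳ (+-congʳ (*-identityʳ y)) ⟩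
    y + a * y ^ suc (suc m) + b * y ^ suc (suc n) ∎
    where
    expand : ∀ y o a b u v → y * (o + y * (a * u + b * v)) ≈ y * o + a * (y * (y * u)) + b * (y * (y * v))
    expand = solve 6 (λ y o a b u v →
      y :* (o :+ y :* (a :* u :+ b :* v)) := y :* o :+ a :* (y :* (y :* u)) :+ b :* (y :* (y :* v))) refl

module Frobenius {c ℓ} (R : CommutativeRing c ℓ) where
  open CommutativeRing R
  open import Algebra.Properties.CommutativeSemiring.Exp commutativeSemiring using (_^_; ^-congˡ; ^-assocʳ)
  open import Algebra.Properties.Semiring.Mult semiring using (×-assoc-*; ×-congʳ; ×1-homo-*) renaming (_×_ to _·_)
  open import Algebra.Properties.CommutativeSemiring.Binomial commutativeSemiring using (theorem)
  open import Algebra.Properties.Semiring.Binomial semiring using (binomialTerm)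
  open import Algebra.Properties.Monoid.Sum +-monoid using (sum; sum-init-last; sum-cong-≋; sum-replicate-zero)
  open import Data.Nat.Combinatorics using (_C_; nCn≡1)
  open import Data.Nat.Divisibility using (_∣_; divides)
  open import Data.Vec.Functional using (init; last; tail)
  open PrimeBinomial using (p∣pCk)
  open import Relation.Binary.Reasoning.Setoid setoid

  [m^j]·1≈[m·1]^j : ∀ m j → (m ℕ.^ j) · 1# ≈ (m · 1#) ^ j
  [m^j]·1≈[m·1]^j m zero = +-identityʳ 1#
  [m^j]·1≈[m·1]^j m (suc j) = trans (×1-homo-* m (m ℕ.^ j)) (*-congˡ ([m^j]·1≈[m·1]^j m j))

  p∣n⇒n·x≈0 : ∀ {p n} → p · 1# ≈ 0# → ∀ x → p ∣ n → n · x ≈ 0#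
  p∣n⇒n·x≈0 {p} {n} p·1≈0 x (divides m ≡.refl) = begin
    n · x                      ≈⟨ ×-congʳ n (*-identityˡ x) ⟨
    n · (1# * x)               ≈⟨ ×-assoc-* n 1# x ⟨
    (n · 1#) * x               ≈⟨ *-congʳ (×1-homo-* m p) ⟩
    ((m · 1#) * (p · 1#)) * x  ≈⟨ *-congʳ (trans (*-congˡ p·1≈0) (zeroʳ _)) ⟩
    0# * x                     ≈⟨ zeroˡ x ⟩
    0#                         ∎

  -- The inner binomial coefficients of the p-th row are divisible by p.
  ^p-homo-+ : ∀ {p} → Prime p → p · 1# ≈ 0# → ∀ x y → (x + y) ^ p ≈ x ^ p + y ^ p
  ^p-homo-+ {zero} p-prime = contradiction p-prime ¬prime[0]
  ^p-homo-+ {suc n} p-prime p·1≈0 x y = begin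
    (x + y) ^ suc n                               ≈⟨ theorem (suc n) x y ⟩
    sum t                                         ≈⟨ sum-init-last t ⟩
    (t Fin.zero + sum (tail (init t))) + last t   ≈⟨ +-congʳ (+-congˡ inner≈0) ⟩
    (t Fin.zero + 0#) + last t                    ≈⟨ +-cong (trans (+-identityʳ _) first) final ⟩
    y ^ suc n + x ^ suc n                         ≈⟨ +-comm _ _ ⟩
    x ^ suc n + y ^ suc n                         ∎
    where
    t = binomialTerm x y (suc n)
    inner : ∀ i → tail (init t) i ≈ 0#
    inner i = p∣n⇒n·x≈0 p·1≈0 _ (p∣pCk p-prime (s≤s z≤n)
      (s≤s (≡.subst (ℕ._< n) (≡.sym (Fin.toℕ-inject₁ i)) (Fin.toℕ<n i))))
    inner≈0 : sum (tail (init t)) ≈ 0#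
    inner≈0 = trans (sum-cong-≋ inner) (sum-replicate-zero n)
    first : t Fin.zero ≈ y ^ suc n
    first = trans (+-identityʳ _) (*-identityˡ _)
    final : last t ≈ x ^ suc n
    final = begin
      last t
        ≡⟨ ≡.cong (λ k → (suc n C k) · (x ^ k * y ^ (suc n ℕ.∸ k))) (Fin.toℕ-fromℕ (suc n)) ⟩
      (suc n C suc n) · (x ^ suc n * y ^ (n ℕ.∸ n))
        ≡⟨ ≡.cong₂ (λ k m → k · (x ^ suc n * y ^ m)) (nCn≡1 (suc n)) (ℕ.n∸n≡0 n) ⟩
      1 · (x ^ suc n * 1#)
        ≈⟨ trans (+-identityʳ _) (*-identityʳ _) ⟩
      x ^ suc n ∎

  ^pᵏ-homo-+ : ∀ {p} → Prime p → p · 1# ≈ 0# → ∀ k x y → (x + y) ^ (p ℕ.^ k) ≈ x ^ (p ℕ.^ k) + y ^ (p ℕ.^ k)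
  ^pᵏ-homo-+ p-prime p·1≈0 zero x y = trans (*-identityʳ _) (sym (+-cong (*-identityʳ x) (*-identityʳ y)))
  ^pᵏ-homo-+ {p} p-prime p·1≈0 (suc k) x y = begin
    (x + y) ^ (p ℕ.* p ℕ.^ k)                ≈⟨ ^-assocʳ (x + y) p (p ℕ.^ k) ⟨
    ((x + y) ^ p) ^ (p ℕ.^ k)                ≈⟨ ^-congˡ (p ℕ.^ k) (^p-homo-+ p-prime p·1≈0 x y) ⟩
    (x ^ p + y ^ p) ^ (p ℕ.^ k)              ≈⟨ ^pᵏ-homo-+ p-prime p·1≈0 k (x ^ p) (y ^ p) ⟩
    (x ^ p) ^ (p ℕ.^ k) + (y ^ p) ^ (p ℕ.^ k) ≈⟨ +-cong (^-assocʳ x p _) (^-assocʳ y p _) ⟩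
    x ^ (p ℕ.* p ℕ.^ k) + y ^ (p ℕ.* p ℕ.^ k) ∎

module FiniteField {c ℓ} (R : CommutativeRing c ℓ) (isField : IsField R) {N} (size : HasSize R N) where
  open CommutativeRing R
  open Field R isField
  open Polynomial R isField
  open import Algebra.Properties.Ring ring using (+-cancelʳ)
  open import Algebra.Properties.CommutativeSemiring.Exp commutativeSemiring using (_^_)
  open import Algebra.Properties.Semiring.Mult semiring using () renaming (_×_ to _·_)
  open import Algebra.Properties.CommutativeMonoid.Sum +-commutativeMonoid
    using (sum-permute; ∑-distrib-+; sum-cong-≋; sum-replicate) renaming (sum to ∑)
  open import Algebra.Properties.CommutativeMonoid.Sum *-commutativeMonoid
    using () renaming ( sum to ∏; sum-permute to ∏-permute; ∑-distrib-+ to ∏-distrib-*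
                      ; sum-cong-≋ to ∏-cong; sum-replicate to ∏-replicate )
  open import Algebra.Properties.CommutativeSemigroup *-commutativeSemigroup using (x∙yz≈y∙xz)
  open import Relation.Binary.Reasoning.Setoid setoid

  element : Fin N → Carrier
  element = proj₁ size

  element-injective : ∀ i j → element i ≈ element j → i ≡ j
  element-injective = proj₁ (proj₂ size)

  index : Carrier → Fin N
  index x = proj₁ (proj₂ (proj₂ size) x)

  element-index : ∀ x → element (index x) ≈ x
  element-index x = proj₂ (proj₂ (proj₂ size) x)

  index-cong : ∀ {x y} → x ≈ y → index x ≡ index y
  index-cong {x} {y} x≈y = element-injective _ _ (trans (element-index x) (trans x≈y (sym (element-index y))))

  index-element : ∀ i → index (element i) ≡ i
  index-element i = element-injective _ _ (element-index (element i))

  infix 4 _≟_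
  _≟_ : Decidable _≈_
  x ≟ y with index x Fin.≟ index y
  ... | yes ix≡iy = yes (trans (sym (element-index x)) (trans (reflexive (≡.cong element ix≡iy)) (element-index y)))
  ... | no ix≢iy = no (λ x≈y → ix≢iy (index-cong x≈y))

  x^n≈0⇒x≈0 : ∀ {x} n → x ^ n ≈ 0# → x ≈ 0#
  x^n≈0⇒x≈0 {x} n xⁿ≈0 with x ≟ 0#
  ... | yes x≈0 = x≈0
  ... | no x≉0 = ⊥-elim (x^n≉0 n x≉0 xⁿ≈0)

  permutationOf : ∀ (f g : Carrier → Carrier) → (∀ {x y} → x ≈ y → f x ≈ f y) → (∀ {x y} → x ≈ y → g x ≈ g y) →
                  (∀ x → f (g x) ≈ x) → (∀ x → g (f x) ≈ x) → Permutation N N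
  permutationOf f g f-cong g-cong fg≈id gf≈id =
    permutation (λ i → index (f (element i))) (λ j → index (g (element j)))
      (undo f g f-cong fg≈id) (undo g f g-cong gf≈id)
    where
    undo : ∀ (f g : Carrier → Carrier) → (∀ {x y} → x ≈ y → f x ≈ f y) → (∀ x → f (g x) ≈ x) →
              ∀ j → index (f (element (index (g (element j))))) ≡ j
    undo f g f-cong fg≈id j =
      ≡.trans (index-cong (trans (f-cong (element-index (g (element j)))) (fg≈id (element j)))) (index-element j)

  ∑-translate : ∀ x → ∑ element ≈ ∑ (λ i → x + element i)
  ∑-translate x = trans (sum-permute element π)
    (sum-cong-≋ {N} {λ i → element (index (x + element i))} (λ i → element-index (x + element i)))
    where
    π = permutationOf (x +_) (- x +_) +-congˡ +-congˡ
          (λ y → trans (sym (+-assoc x (- x) y)) (trans (+-congʳ (-‿inverseʳ x)) (+-identityˡ y)))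
          (λ y → trans (sym (+-assoc (- x) x y)) (trans (+-congʳ (-‿inverseˡ x)) (+-identityˡ y)))

  characteristic : ∀ x → N · x ≈ 0#
  characteristic x = sym (+-cancelʳ (∑ element) 0# (N · x) (begin
    0# + ∑ element                      ≈⟨ +-identityˡ _ ⟩
    ∑ element                           ≈⟨ ∑-translate x ⟩
    ∑ (λ i → x + element i)             ≈⟨ ∑-distrib-+ (λ _ → x) element ⟩
    ∑ (replicate N x) + ∑ element       ≈⟨ +-congʳ (sum-replicate N) ⟩
    N · x + ∑ element                   ∎))

  ∏≉0 : ∀ {n} (f : Vector Carrier n) → (∀ i → f i ≉ 0#) → ∏ f ≉ 0#
  ∏≉0 {zero} f f≉0 = 1≉0
  ∏≉0 {suc n} f f≉0 = x*y≉0 (f≉0 Fin.zero) (∏≉0 (tail f) (f≉0 ∘ Fin.suc))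

  x*∏≈x^n : ∀ {x n} (f : Vector Carrier n) i₀ → f i₀ ≈ 1# → (∀ i → i ≢ i₀ → f i ≈ x) → x * ∏ f ≈ x ^ n
  x*∏≈x^n {x} {suc n} f Fin.zero f₀≈1 f≈x = *-congˡ (begin
    f Fin.zero * ∏ (tail f)  ≈⟨ *-congʳ f₀≈1 ⟩
    1# * ∏ (tail f)          ≈⟨ *-identityˡ _ ⟩
    ∏ (tail f)               ≈⟨ ∏-cong (λ i → f≈x (Fin.suc i) (λ ())) ⟩
    ∏ (replicate n x)        ≈⟨ ∏-replicate n ⟩
    x ^ n                    ∎)
  x*∏≈x^n {x} {suc n} f (Fin.suc i₀) fᵢ₀≈1 f≈x = begin
    x * (f Fin.zero * ∏ (tail f))  ≈⟨ *-congˡ (*-congʳ (f≈x Fin.zero (λ ()))) ⟩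
    x * (x * ∏ (tail f))           ≈⟨ *-congˡ (x*∏≈x^n (tail f) i₀ fᵢ₀≈1 f≈x′) ⟩
    x * x ^ n                      ∎
    where
    f≈x′ : ∀ i → i ≢ i₀ → tail f i ≈ x
    f≈x′ i i≢i₀ = f≈x (Fin.suc i) (i≢i₀ ∘ Fin.suc-injective)

  nonzeroPart : Carrier → Carrier
  nonzeroPart a with a ≟ 0#
  ... | yes _ = 1#
  ... | no _ = a

  nonzeroPart-cong : ∀ {a b} → a ≈ b → nonzeroPart a ≈ nonzeroPart b
  nonzeroPart-cong {a} {b} a≈b with a ≟ 0# | b ≟ 0#
  ... | yes _ | yes _ = refl
  ... | yes a≈0 | no b≉0 = ⊥-elim (b≉0 (trans (sym a≈b) a≈0))
  ... | no a≉0 | yes b≈0 = ⊥-elim (a≉0 (trans a≈b b≈0))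
  ... | no _ | no _ = a≈b

  nonzeroPart≉0 : ∀ a → nonzeroPart a ≉ 0#
  nonzeroPart≉0 a with a ≟ 0#
  ... | yes _ = 1≉0
  ... | no a≉0 = a≉0

  nonzeroFactor : Carrier → Carrier → Carrier
  nonzeroFactor x a with a ≟ 0#
  ... | yes _ = 1#
  ... | no _ = x

  nonzeroPart-* : ∀ {x} → x ≉ 0# → ∀ a → nonzeroPart (x * a) ≈ nonzeroFactor x a * nonzeroPart a
  nonzeroPart-* {x} x≉0 a with a ≟ 0# | x * a ≟ 0#
  ... | yes _ | yes _ = sym (*-identityˡ 1#)
  ... | yes a≈0 | no xa≉0 = ⊥-elim (xa≉0 (trans (*-congˡ a≈0) (zeroʳ x)))
  ... | no a≉0 | yes xa≈0 = ⊥-elim (x*y≉0 x≉0 a≉0 xa≈0)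
  ... | no _ | no _ = refl

  x*∏nonzeroFactor≈x^N : ∀ x → x * ∏ (nonzeroFactor x ∘ element) ≈ x ^ N
  x*∏nonzeroFactor≈x^N x = x*∏≈x^n (nonzeroFactor x ∘ element) (index 0#) at-0 elsewhere
    where
    at-0 : nonzeroFactor x (element (index 0#)) ≈ 1#
    at-0 with element (index 0#) ≟ 0#
    ... | yes _ = refl
    ... | no e≉0 = ⊥-elim (e≉0 (element-index 0#))

    elsewhere : ∀ i → i ≢ index 0# → nonzeroFactor x (element i) ≈ x
    elsewhere i i≢i₀ with element i ≟ 0#
    ... | yes eᵢ≈0 = ⊥-elim (i≢i₀ (≡.trans (≡.sym (index-element i)) (index-cong eᵢ≈0)))
    ... | no _ = refl

  -- Multiplying by x permutes the field, and multiplies the nonzero part of every element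
  -- except 0 by x, so the product of the nonzero parts is unchanged.
  ∏nonzeroFactor≈1 : ∀ {x} → x ≉ 0# → ∏ (nonzeroFactor x ∘ element) ≈ 1#
  ∏nonzeroFactor≈1 {x} x≉0 = sym (*-cancelˡ (∏≉0 _ (nonzeroPart≉0 ∘ element)) (begin
    P * 1#                                                   ≈⟨ *-identityʳ P ⟩
    P                                                        ≈⟨ ∏-permute _ π ⟩
    ∏ (λ i → nonzeroPart (element (index (x * element i))))  ≈⟨ ∏-cong (λ i → trans (nonzeroPart-cong (element-index _))
                                                                                     (nonzeroPart-* x≉0 (element i))) ⟩
    ∏ (λ i → nonzeroFactor x (element i) * nonzeroPart (element i))
                                                             ≈⟨ ∏-distrib-* (nonzeroFactor x ∘ element) (nonzeroPart ∘ element) ⟩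
    ∏ (nonzeroFactor x ∘ element) * P                        ≈⟨ *-comm _ P ⟩
    P * ∏ (nonzeroFactor x ∘ element)                        ∎))
    where
    P = ∏ (nonzeroPart ∘ element)
    x⁻¹ = proj₁ (inverse x x≉0)

    x*[x⁻¹*y]≈y : ∀ y → x * (x⁻¹ * y) ≈ y
    x*[x⁻¹*y]≈y y = trans (sym (*-assoc x x⁻¹ y)) (trans (*-congʳ (proj₂ (inverse x x≉0))) (*-identityˡ y))

    π = permutationOf (x *_) (x⁻¹ *_) *-congˡ *-congˡ x*[x⁻¹*y]≈y (λ y → trans (x∙yz≈y∙xz x⁻¹ x y) (x*[x⁻¹*y]≈y y))

  x^N≈x : ∀ x → x ^ N ≈ x
  x^N≈x x with x ≟ 0#
  ... | yes x≈0 = 0^n≈0 (index 0#)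
    -- index 0# : Fin N shows that N ≠ 0.
    where
    0^n≈0 : ∀ {n} → Fin n → x ^ n ≈ x
    0^n≈0 {suc n} _ = trans (*-congʳ x≈0) (trans (zeroˡ _) (sym x≈0))
  ... | no x≉0 = begin
    x ^ N                                ≈⟨ x*∏nonzeroFactor≈x^N x ⟨
    x * ∏ (nonzeroFactor x ∘ element)    ≈⟨ *-congˡ (∏nonzeroFactor≈1 x≉0) ⟩
    x * 1#                               ≈⟨ *-identityʳ x ⟩
    x                                    ∎

  ∃-nonroot : ∀ as → length as ≤ N → ¬ All (_≈ 0#) as → ∃[ y ] (eval as y ≉ 0#)
  ∃-nonroot as |as|≤N as≉0 with Fin.¬∀⟶∃¬ N (λ i → eval as (element i) ≈ 0#) (λ i → eval as (element i) ≟ 0#)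
                                    (λ roots → as≉0 (rootBound as element element-injective |as|≤N roots))
  ... | i , nonroot = element i , nonroot

  trinomial-nonroot : ∀ a b {m n} → 2 ≤ m → 2 ≤ n → m < N → n < N → ∃[ y ] (y + a * y ^ m + b * y ^ n ≉ 0#)
  trinomial-nonroot a b {suc (suc m)} {suc (suc n)} (s≤s (s≤s _)) (s≤s (s≤s _)) m<N n<N
    with ∃-nonroot (trinomial a b m n) (ℕ.≤-trans (length-trinomial a b m n) (ℕ.⊔-lub m<N n<N))
                   (λ { (_ ∷ 1≈0 ∷ _) → 1≉0 1≈0 })
  ... | y , nonroot = y , λ value≈0 → nonroot (trans (eval-trinomial a b m n y) value≈0)

module CubicExtension {c ℓ} (R : CommutativeRing c ℓ) {q} (q-primePower : IsPrimePower q)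
                      (isField : IsField R) (size : HasSize R (q ℕ.^ 3)) where
  open CommutativeRing R
  open Field R isField
  open FiniteField R isField size
  open Frobenius R
  open IntegerCoefficientSolver R using (solve; _:+_; _:*_; _:=_)
  open import Algebra.Properties.Ring ring using (+-inverseˡ-unique; +-identityʳ-unique)
  open import Algebra.Properties.CommutativeSemiring.Exp commutativeSemiring using (_^_; ^-congˡ; ^-assocʳ; ^-distrib-*)
  open import Algebra.Properties.Semiring.Mult semiring using () renaming (_×_ to _·_)
  open import Relation.Binary.Reasoning.Setoid setoid

  private
    p = proj₁ q-primePower
    k = proj₁ (proj₂ q-primePower)
    p-prime : Prime p
    p-prime = proj₁ (proj₂ (proj₂ q-primePower))
    1≤k : 1 ≤ k
    1≤k = proj₁ (proj₂ (proj₂ (proj₂ q-primePower)))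
    q≡pᵏ : q ≡ p ℕ.^ k
    q≡pᵏ = proj₂ (proj₂ (proj₂ (proj₂ q-primePower)))

  1<q : 1 < q
  1<q = ≡.subst (1 <_) (≡.sym q≡pᵏ) (ℕ.^-monoʳ-< p (ℕ.nonTrivial⇒n>1 p ⦃ prime⇒nonTrivial p-prime ⦄) 1≤k)

  1<q² : 1 < q ℕ.* q
  1<q² = ℕ.≤-trans 1<q (ℕ.m≤m*n q q ⦃ ℕ.>-nonZero (ℕ.<-trans ℕ.z<s 1<q) ⦄)

  q<q³ : q < q ℕ.^ 3
  q<q³ = ≡.subst (ℕ._< q ℕ.^ 3) (ℕ.*-identityʳ q) (ℕ.^-monoʳ-< q 1<q {1} {3} (s≤s (s≤s z≤n)))

  q²<q³ : q ℕ.* q < q ℕ.^ 3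
  q²<q³ = ≡.subst (ℕ._< q ℕ.^ 3) (≡.cong (q ℕ.*_) (ℕ.*-identityʳ q)) (ℕ.^-monoʳ-< q 1<q {2} {3} (s≤s (s≤s (s≤s z≤n))))

  p·1≈0 : p · 1# ≈ 0#
  p·1≈0 = x^n≈0⇒x≈0 (k ℕ.* 3) (begin
    (p · 1#) ^ (k ℕ.* 3)   ≈⟨ [m^j]·1≈[m·1]^j p (k ℕ.* 3) ⟨
    (p ℕ.^ (k ℕ.* 3)) · 1# ≡⟨ ≡.cong (_· 1#) (≡.trans (≡.sym (ℕ.^-*-assoc p k 3)) (≡.cong (ℕ._^ 3) (≡.sym q≡pᵏ))) ⟩
    (q ℕ.^ 3) · 1#         ≈⟨ characteristic 1# ⟩
    0#                     ∎)

  σ : Carrier → Carrier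
  σ x = x ^ q

  σ-cong : ∀ {x y} → x ≈ y → σ x ≈ σ y
  σ-cong = ^-congˡ q

  σ-homo-+ : ∀ x y → σ (x + y) ≈ σ x + σ y
  σ-homo-+ x y = ≡.subst (λ n → (x + y) ^ n ≈ x ^ n + y ^ n) (≡.sym q≡pᵏ) (^pᵏ-homo-+ p-prime p·1≈0 k x y)

  σ-homo-* : ∀ x y → σ (x * y) ≈ σ x * σ y
  σ-homo-* x y = ^-distrib-* x y q

  σ-1 : σ 1# ≈ 1#
  σ-1 = 1^n≈1 q
    where
    1^n≈1 : ∀ n → 1# ^ n ≈ 1#
    1^n≈1 zero = refl
    1^n≈1 (suc n) = trans (*-identityˡ _) (1^n≈1 n)

  σ-0 : σ 0# ≈ 0#
  σ-0 = +-identityʳ-unique (σ 0#) (σ 0#) (trans (sym (σ-homo-+ 0# 0#)) (σ-cong (+-identityʳ 0#)))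

  σ≈0 : ∀ {x} → x ≈ 0# → σ x ≈ 0#
  σ≈0 x≈0 = trans (σ-cong x≈0) σ-0

  σ-homo-neg : ∀ x → σ (- x) ≈ - σ x
  σ-homo-neg x = +-inverseˡ-unique (σ (- x)) (σ x) (begin
    σ (- x) + σ x  ≈⟨ σ-homo-+ (- x) x ⟨
    σ (- x + x)    ≈⟨ σ-cong (-‿inverseˡ x) ⟩
    σ 0#           ≈⟨ σ-0 ⟩
    0#             ∎)

  σ³≈id : ∀ x → σ (σ (σ x)) ≈ x
  σ³≈id x = begin
    ((x ^ q) ^ q) ^ q      ≈⟨ ^-congˡ q (^-assocʳ x q q) ⟩
    (x ^ (q ℕ.* q)) ^ q    ≈⟨ ^-assocʳ x (q ℕ.* q) q ⟩
    x ^ (q ℕ.* q ℕ.* q)    ≡⟨ ≡.cong (x ^_) q·q·q≡q³ ⟩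
    x ^ (q ℕ.^ 3)          ≈⟨ x^N≈x x ⟩
    x                      ∎
    where
    q·q·q≡q³ : q ℕ.* q ℕ.* q ≡ q ℕ.^ 3
    q·q·q≡q³ = ≡.trans (ℕ.*-assoc q q q) (≡.cong (λ n → q ℕ.* (q ℕ.* n)) (≡.sym (ℕ.*-identityʳ q)))

  σx≈0⇒x≈0 : ∀ {x} → σ x ≈ 0# → x ≈ 0#
  σx≈0⇒x≈0 {x} σx≈0 = trans (sym (σ³≈id x)) (σ≈0 (σ≈0 σx≈0))

  norm : Carrier → Carrier
  norm x = x * σ x * σ (σ x)

  norm-cong : ∀ {x y} → x ≈ y → norm x ≈ norm y
  norm-cong x≈y = *-cong (*-cong x≈y (σ-cong x≈y)) (σ-cong (σ-cong x≈y))

  norm-homo-* : ∀ x y → norm (x * y) ≈ norm x * norm y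
  norm-homo-* x y = begin
    (x * y) * σ (x * y) * σ (σ (x * y))
      ≈⟨ *-cong (*-congˡ (σ-homo-* x y)) (trans (σ-cong (σ-homo-* x y)) (σ-homo-* (σ x) (σ y))) ⟩
    (x * y) * (σ x * σ y) * (σ (σ x) * σ (σ y))
      ≈⟨ regroup x y (σ x) (σ y) (σ (σ x)) (σ (σ y)) ⟩
    norm x * norm y ∎
    where
    regroup : ∀ x y x′ y′ x″ y″ → (x * y) * (x′ * y′) * (x″ * y″) ≈ (x * x′ * x″) * (y * y′ * y″)
    regroup = solve 6 (λ x y x′ y′ x″ y″ → (x :* y) :* (x′ :* y′) :* (x″ :* y″) := (x :* x′ :* x″) :* (y :* y′ :* y″)) refl

  norm-0 : norm 0# ≈ 0#
  norm-0 = trans (*-congʳ (zeroˡ _)) (zeroˡ _)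

  norm-1 : norm 1# ≈ 1#
  norm-1 = trans (*-cong (trans (*-identityˡ _) σ-1) (trans (σ-cong σ-1) σ-1)) (*-identityˡ 1#)

  σ-≉0 : ∀ {x} → x ≉ 0# → σ x ≉ 0#
  σ-≉0 x≉0 σx≈0 = x≉0 (σx≈0⇒x≈0 σx≈0)

  norm≈0⇒x≈0 : ∀ {x} → norm x ≈ 0# → x ≈ 0#
  norm≈0⇒x≈0 {x} nx≈0 with x ≟ 0#
  ... | yes x≈0 = x≈0
  ... | no x≉0 = ⊥-elim (x*y≉0 (x*y≉0 x≉0 (σ-≉0 x≉0)) (σ-≉0 (σ-≉0 x≉0)) nx≈0)

  -- With t = σ s σ² s (the inverse of s when norm s = 1), every a = y + t σ y + σ² s σ² y
  -- satisfies σ a = s a; a nonzero one exists as a is a polynomial in y of degree q² < q³.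
  hilbert90 : ∀ {s} → norm s ≈ 1# → ∃[ a ] (a ≉ 0# × σ a ≈ s * a)
  hilbert90 {s} ns≈1 with trinomial-nonroot (σ s * σ (σ s)) (σ (σ s)) 1<q 1<q² q<q³ q²<q³
  ... | y , nonroot = a , a≉0 , σa≈sa
    where
    t = σ s * σ (σ s)
    a = y + t * σ y + σ (σ s) * σ (σ y)

    a≉0 : a ≉ 0#
    a≉0 a≈0 = nonroot (trans (+-congˡ (*-congˡ (sym (^-assocʳ y q q)))) a≈0)

    σa≈sa : σ a ≈ s * a
    σa≈sa = begin
      σ a
        ≈⟨ trans (σ-homo-+ _ _) (+-cong (trans (σ-homo-+ _ _) (+-congˡ (σ-homo-* t (σ y)))) (σ-homo-* (σ (σ s)) (σ (σ y)))) ⟩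
      σ y + σ t * σ (σ y) + σ (σ (σ s)) * σ (σ (σ y))
        ≈⟨ +-cong (+-congˡ (*-congʳ (trans (σ-homo-* (σ s) (σ (σ s))) (*-congˡ (σ³≈id s))))) (*-cong (σ³≈id s) (σ³≈id y)) ⟩
      σ y + (σ (σ s) * s) * σ (σ y) + s * y
        ≈⟨ +-congʳ (+-congʳ (sym (trans (*-congʳ ns≈1) (*-identityˡ (σ y))))) ⟩
      norm s * σ y + (σ (σ s) * s) * σ (σ y) + s * y
        ≈⟨ expand s (σ s) (σ (σ s)) y (σ y) (σ (σ y)) ⟨
      s * a ∎
      where
      expand : ∀ s s′ s″ y y′ y″ → s * (y + (s′ * s″) * y′ + s″ * y″) ≈ (s * s′ * s″) * y′ + (s″ * s) * y″ + s * y
      expand = solve 6 (λ s s′ s″ y y′ y″ →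
        s :* (y :+ (s′ :* s″) :* y′ :+ s″ :* y″) := (s :* s′ :* s″) :* y′ :+ (s″ :* s) :* y″ :+ s :* y) refl

  -- Hilbert 90 applied to y / x.
  equalNorms⇒proportional : ∀ {x y} → x ≉ 0# → norm x ≈ norm y → ∃[ a ] (a ≉ 0# × ∃[ k ] (k ≉ 0# × x ≈ k * a × y ≈ k * σ a))
  equalNorms⇒proportional {x} {y} x≉0 Nx≈Ny = a , a≉0 , x * a⁻¹ , x*y≉0 x≉0 a⁻¹≉0 , x≈ka , y≈kσa
    where
    x⁻¹ = proj₁ (inverse x x≉0)
    xx⁻¹≈1 = proj₂ (inverse x x≉0)

    norm[y/x]≈1 : norm (y * x⁻¹) ≈ 1#
    norm[y/x]≈1 = begin
      norm (y * x⁻¹)       ≈⟨ norm-homo-* y x⁻¹ ⟩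
      norm y * norm x⁻¹    ≈⟨ *-congʳ Nx≈Ny ⟨
      norm x * norm x⁻¹    ≈⟨ norm-homo-* x x⁻¹ ⟨
      norm (x * x⁻¹)       ≈⟨ norm-cong xx⁻¹≈1 ⟩
      norm 1#              ≈⟨ norm-1 ⟩
      1#                   ∎

    a = proj₁ (hilbert90 norm[y/x]≈1)
    a≉0 = proj₁ (proj₂ (hilbert90 norm[y/x]≈1))
    σa≈[y/x]a = proj₂ (proj₂ (hilbert90 norm[y/x]≈1))
    a⁻¹ = proj₁ (inverse a a≉0)
    aa⁻¹≈1 = proj₂ (inverse a a≉0)

    a⁻¹≉0 : a⁻¹ ≉ 0#
    a⁻¹≉0 a⁻¹≈0 = 1≉0 (trans (sym aa⁻¹≈1) (trans (*-congˡ a⁻¹≈0) (zeroʳ a)))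

    x≈ka : x ≈ x * a⁻¹ * a
    x≈ka = sym (begin
      x * a⁻¹ * a    ≈⟨ *-assoc x a⁻¹ a ⟩
      x * (a⁻¹ * a)  ≈⟨ *-congˡ (trans (*-comm a⁻¹ a) aa⁻¹≈1) ⟩
      x * 1#         ≈⟨ *-identityʳ x ⟩
      x              ∎)

    y≈kσa : y ≈ x * a⁻¹ * σ a
    y≈kσa = sym (begin
      x * a⁻¹ * σ a                 ≈⟨ *-congˡ σa≈[y/x]a ⟩
      x * a⁻¹ * (y * x⁻¹ * a)       ≈⟨ regroup x a⁻¹ y x⁻¹ a ⟩
      y * ((x * x⁻¹) * (a * a⁻¹))   ≈⟨ *-congˡ (*-cong xx⁻¹≈1 aa⁻¹≈1) ⟩
      y * (1# * 1#)                 ≈⟨ trans (*-congˡ (*-identityˡ 1#)) (*-identityʳ y) ⟩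
      y                             ∎)
      where
      regroup : ∀ x b y x′ a → x * b * (y * x′ * a) ≈ y * ((x * x′) * (a * b))
      regroup = solve 5 (λ x b y x′ a → x :* b :* (y :* x′ :* a) := y :* ((x :* x′) :* (a :* b))) refl

module PlaneCoordinates {c ℓ} (R : CommutativeRing c ℓ) (isField : IsField R)
                        (_≟_ : Decidable (CommutativeRing._≈_ R)) (q : ℕ) where
  open CommutativeRing R
  open Field R isField
  open PG R q
  open IntegerCoefficientSolver R using (solve; _:+_; _:*_; :-_; _:-_; _:=_; Polynomial; :0)
  open import Algebra.Properties.Ring ring using (x∙y⁻¹≈ε⇒x≈y; x≈y⇒x∙y⁻¹≈ε; -‿injective; -0#≈0#)
  open import Relation.Binary.Reasoning.Setoid setoid

  infix 4 _≋_
  _≋_ : V3 → V3 → Set ℓ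
  u ≋ v = (x₁ u ≈ x₁ v) × (x₂ u ≈ x₂ v) × (x₃ u ≈ x₃ v)

  ≋-refl : ∀ {u} → u ≋ u
  ≋-refl = refl , refl , refl

  ≋-sym : ∀ {u v} → u ≋ v → v ≋ u
  ≋-sym (e₁ , e₂ , e₃) = sym e₁ , sym e₂ , sym e₃

  ≋-trans : ∀ {u v w} → u ≋ v → v ≋ w → u ≋ w
  ≋-trans (e₁ , e₂ , e₃) (f₁ , f₂ , f₃) = trans e₁ f₁ , trans e₂ f₂ , trans e₃ f₃

  -- Inc P L unfolds to dot L P ≈ 0#.
  dot : V3 → V3 → Carrier
  dot L P = x₁ L * x₁ P + x₂ L * x₂ P + x₃ L * x₃ P

  dot-cong : ∀ {L L′ P P′} → L ≋ L′ → P ≋ P′ → dot L P ≈ dot L′ P′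
  dot-cong (e₁ , e₂ , e₃) (f₁ , f₂ , f₃) = +-cong (+-cong (*-cong e₁ f₁) (*-cong e₂ f₂)) (*-cong e₃ f₃)

  Inc-cong : ∀ {P P′ L L′} → P ≋ P′ → L ≋ L′ → Inc P L → Inc P′ L′
  Inc-cong P≋P′ L≋L′ P∈L = trans (sym (dot-cong L≋L′ P≋P′)) P∈L

  cross : V3 → V3 → V3
  cross u v = ⟨ x₂ u * x₃ v - x₃ u * x₂ v , x₃ u * x₁ v - x₁ u * x₃ v , x₁ u * x₂ v - x₂ u * x₁ v ⟩

  det : V3 → V3 → V3 → Carrier
  det A B C = dot A (cross B C)

  cross-cong : ∀ {u u′ v v′} → u ≋ u′ → v ≋ v′ → cross u v ≋ cross u′ v′
  cross-cong (e₁ , e₂ , e₃) (f₁ , f₂ , f₃) =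
    -cong (*-cong e₂ f₃) (*-cong e₃ f₂) , -cong (*-cong e₃ f₁) (*-cong e₁ f₃) , -cong (*-cong e₁ f₂) (*-cong e₂ f₁)
    where
    -cong : ∀ {a a′ b b′} → a ≈ a′ → b ≈ b′ → a - b ≈ a′ - b′
    -cong a≈a′ b≈b′ = +-cong a≈a′ (-‿cong b≈b′)

  private
    module Expression {n : ℕ} where
      record V3ₑ : Set c where
        constructor ⟪_,_,_⟫
        field y₁ y₂ y₃ : Polynomial n

      dotₑ : V3ₑ → V3ₑ → Polynomial n
      dotₑ ⟪ l₁ , l₂ , l₃ ⟫ ⟪ p₁ , p₂ , p₃ ⟫ = l₁ :* p₁ :+ l₂ :* p₂ :+ l₃ :* p₃

      crossₑ : V3ₑ → V3ₑ → V3ₑ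
      crossₑ ⟪ u₁ , u₂ , u₃ ⟫ ⟪ v₁ , v₂ , v₃ ⟫ =
        ⟪ u₂ :* v₃ :- u₃ :* v₂ , u₃ :* v₁ :- u₁ :* v₃ , u₁ :* v₂ :- u₂ :* v₁ ⟫
    open Expression

  cross-onˡ : ∀ u v → Inc (cross u v) u
  cross-onˡ ⟨ u₁ , u₂ , u₃ ⟩ ⟨ v₁ , v₂ , v₃ ⟩ = solve 6 (λ u₁ u₂ u₃ v₁ v₂ v₃ →
    dotₑ ⟪ u₁ , u₂ , u₃ ⟫ (crossₑ ⟪ u₁ , u₂ , u₃ ⟫ ⟪ v₁ , v₂ , v₃ ⟫) := :0) refl u₁ u₂ u₃ v₁ v₂ v₃

  cross-onʳ : ∀ u v → Inc (cross u v) v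
  cross-onʳ ⟨ u₁ , u₂ , u₃ ⟩ ⟨ v₁ , v₂ , v₃ ⟩ = solve 6 (λ u₁ u₂ u₃ v₁ v₂ v₃ →
    dotₑ ⟪ v₁ , v₂ , v₃ ⟫ (crossₑ ⟪ u₁ , u₂ , u₃ ⟫ ⟪ v₁ , v₂ , v₃ ⟫) := :0) refl u₁ u₂ u₃ v₁ v₂ v₃

  Adjugate : (V3 → Carrier) → V3 → V3 → V3 → V3 → Set ℓ
  Adjugate x A B C W = det A B C * x W ≈ x (cross B C) * dot A W + x (cross C A) * dot B W + x (cross A B) * dot C W

  adjugate : ∀ A B C W → Adjugate x₁ A B C W × Adjugate x₂ A B C W × Adjugate x₃ A B C W
  adjugate ⟨ a₁ , a₂ , a₃ ⟩ ⟨ b₁ , b₂ , b₃ ⟩ ⟨ c₁ , c₂ , c₃ ⟩ ⟨ w₁ , w₂ , w₃ ⟩ =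
    solve 12 (λ a₁ a₂ a₃ b₁ b₂ b₃ c₁ c₂ c₃ w₁ w₂ w₃ →
      let A = ⟪ a₁ , a₂ , a₃ ⟫ ; B = ⟪ b₁ , b₂ , b₃ ⟫ ; C = ⟪ c₁ , c₂ , c₃ ⟫ ; W = ⟪ w₁ , w₂ , w₃ ⟫ in
      dotₑ A (crossₑ B C) :* w₁
        := V3ₑ.y₁ (crossₑ B C) :* dotₑ A W :+ V3ₑ.y₁ (crossₑ C A) :* dotₑ B W :+ V3ₑ.y₁ (crossₑ A B) :* dotₑ C W)
      refl a₁ a₂ a₃ b₁ b₂ b₃ c₁ c₂ c₃ w₁ w₂ w₃ ,
    solve 12 (λ a₁ a₂ a₃ b₁ b₂ b₃ c₁ c₂ c₃ w₁ w₂ w₃ →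
      let A = ⟪ a₁ , a₂ , a₃ ⟫ ; B = ⟪ b₁ , b₂ , b₃ ⟫ ; C = ⟪ c₁ , c₂ , c₃ ⟫ ; W = ⟪ w₁ , w₂ , w₃ ⟫ in
      dotₑ A (crossₑ B C) :* w₂
        := V3ₑ.y₂ (crossₑ B C) :* dotₑ A W :+ V3ₑ.y₂ (crossₑ C A) :* dotₑ B W :+ V3ₑ.y₂ (crossₑ A B) :* dotₑ C W)
      refl a₁ a₂ a₃ b₁ b₂ b₃ c₁ c₂ c₃ w₁ w₂ w₃ ,
    solve 12 (λ a₁ a₂ a₃ b₁ b₂ b₃ c₁ c₂ c₃ w₁ w₂ w₃ →
      let A = ⟪ a₁ , a₂ , a₃ ⟫ ; B = ⟪ b₁ , b₂ , b₃ ⟫ ; C = ⟪ c₁ , c₂ , c₃ ⟫ ; W = ⟪ w₁ , w₂ , w₃ ⟫ in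
      dotₑ A (crossₑ B C) :* w₃
        := V3ₑ.y₃ (crossₑ B C) :* dotₑ A W :+ V3ₑ.y₃ (crossₑ C A) :* dotₑ B W :+ V3ₑ.y₃ (crossₑ A B) :* dotₑ C W)
      refl a₁ a₂ a₃ b₁ b₂ b₃ c₁ c₂ c₃ w₁ w₂ w₃

  det≉0⇒¬Concurrent : ∀ {A B C} → det A B C ≉ 0# → ¬ Concurrent A B C
  det≉0⇒¬Concurrent {A} {B} {C} det≉0 (W , W≢0 , W∈A , W∈B , W∈C) =
    let adj₁ , adj₂ , adj₃ = adjugate A B C W in W≢0 (vanish adj₁ , vanish adj₂ , vanish adj₃)
    where
    vanish : ∀ {x} → Adjugate x A B C W → x W ≈ 0#
    vanish {x} adj = x*y≈0⇒y≈0 det≉0 (begin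
      det A B C * x W                                                             ≈⟨ adj ⟩
      x (cross B C) * dot A W + x (cross C A) * dot B W + x (cross A B) * dot C W ≈⟨ +-cong (+-cong (*-congˡ W∈A) (*-congˡ W∈B)) (*-congˡ W∈C) ⟩
      x (cross B C) * 0# + x (cross C A) * 0# + x (cross A B) * 0#                ≈⟨ +-cong (+-cong (zeroʳ _) (zeroʳ _)) (zeroʳ _) ⟩
      0# + 0# + 0#                                                                ≈⟨ trans (+-identityʳ _) (+-identityʳ _) ⟩
      0#                                                                          ∎)

  e₁ e₂ : V3
  e₁ = ⟨ 1# , 0# , 0# ⟩
  e₂ = ⟨ 0# , 1# , 0# ⟩

  dot-e₁ : ∀ L → dot L e₁ ≈ x₁ L
  dot-e₁ L = trans (+-cong (+-cong (*-identityʳ _) (zeroʳ _)) (zeroʳ _)) (trans (+-identityʳ _) (+-identityʳ _))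

  dot-e₂ : ∀ L → dot L e₂ ≈ x₂ L
  dot-e₂ L = trans (+-cong (+-cong (zeroʳ _) (*-identityʳ _)) (zeroʳ _)) (trans (+-identityʳ _) (+-identityˡ _))

  dot-T : ∀ L → dot L T ≈ x₃ L
  dot-T L = trans (+-cong (+-cong (zeroʳ _) (zeroʳ _)) (*-identityʳ _)) (trans (+-congʳ (+-identityʳ _)) (+-identityˡ _))

  dot-axis₁ : ∀ c P → dot ⟨ c , 0# , 0# ⟩ P ≈ c * x₁ P
  dot-axis₁ c P = trans (+-cong (+-congˡ (zeroˡ _)) (zeroˡ _)) (trans (+-identityʳ _) (+-identityʳ _))

  dot-axis₂ : ∀ c P → dot ⟨ 0# , c , 0# ⟩ P ≈ c * x₂ P
  dot-axis₂ c P = trans (+-cong (+-congʳ (zeroˡ _)) (zeroˡ _)) (trans (+-identityʳ _) (+-identityˡ _))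

  Inc-mT : ∀ {X} → Inc X mT → x₃ X ≈ 0#
  Inc-mT {X} X∈mT = trans (sym (trans (+-cong (+-cong (zeroˡ _) (zeroˡ _)) (*-identityˡ _))
                                       (trans (+-congʳ (+-identityʳ _)) (+-identityˡ _)))) X∈mT

  dot-throughT : ∀ {L} Y → x₃ L ≈ 0# → dot L Y ≈ x₁ L * x₁ Y + x₂ L * x₂ Y
  dot-throughT Y l₃≈0 = trans (+-congˡ (trans (*-congʳ l₃≈0) (zeroˡ _))) (+-identityʳ _)

  ∼T : ∀ {P} → NZ P → x₁ P ≈ 0# → x₂ P ≈ 0# → P ∼ T
  ∼T {P} P≢0 p₁≈0 p₂≈0 = x₃ P , (λ p₃≈0 → P≢0 (p₁≈0 , p₂≈0 , p₃≈0)) ,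
    trans p₁≈0 (sym (zeroʳ _)) , trans p₂≈0 (sym (zeroʳ _)) , sym (*-identityʳ _)

  a*u+b*v≈0 : ∀ {a b u v} → u ≈ 0# → v ≈ 0# → a * u + b * v ≈ 0#
  a*u+b*v≈0 u≈0 v≈0 = trans (+-cong (trans (*-congˡ u≈0) (zeroʳ _)) (trans (*-congˡ v≈0) (zeroʳ _))) (+-identityʳ 0#)

  a*u-b*v≈0 : ∀ {a b u v} → u ≈ 0# → v ≈ 0# → a * u - b * v ≈ 0#
  a*u-b*v≈0 u≈0 v≈0 = trans (+-cong (trans (*-congˡ u≈0) (zeroʳ _)) (-‿cong (trans (*-congˡ v≈0) (zeroʳ _)))) (-‿inverseʳ 0#)

  throughT-proportional : ∀ {L P X} → NZ L → Inc T L → Inc P L → Inc X L → x₁ X * x₂ P ≈ x₂ X * x₁ P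
  throughT-proportional {L} {P} {X} L≢0 T∈L P∈L X∈L with (x₁ X * x₂ P - x₂ X * x₁ P) ≟ 0#
  ... | yes D≈0 = x∙y⁻¹≈ε⇒x≈y _ _ D≈0
  ... | no D≉0 = ⊥-elim (L≢0 (x*y≈0⇒x≈0 D≉0 (trans (eliminate₁ l₁ l₂ ξ₁ ξ₂ p₁ p₂) (a*u-b*v≈0 X∈L′ P∈L′)) ,
                              x*y≈0⇒x≈0 D≉0 (trans (eliminate₂ l₁ l₂ ξ₁ ξ₂ p₁ p₂) (a*u-b*v≈0 P∈L′ X∈L′)) , l₃≈0))
    where
    open V3 L using () renaming (x₁ to l₁; x₂ to l₂)
    open V3 P using () renaming (x₁ to p₁; x₂ to p₂)
    open V3 X using () renaming (x₁ to ξ₁; x₂ to ξ₂)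
    l₃≈0 = trans (sym (dot-T L)) T∈L
    P∈L′ : l₁ * p₁ + l₂ * p₂ ≈ 0#
    P∈L′ = trans (sym (dot-throughT P l₃≈0)) P∈L
    X∈L′ : l₁ * ξ₁ + l₂ * ξ₂ ≈ 0#
    X∈L′ = trans (sym (dot-throughT X l₃≈0)) X∈L
    eliminate₁ : ∀ l₁ l₂ x₁ x₂ p₁ p₂ → l₁ * (x₁ * p₂ - x₂ * p₁) ≈ p₂ * (l₁ * x₁ + l₂ * x₂) - x₂ * (l₁ * p₁ + l₂ * p₂)
    eliminate₁ = solve 6 (λ l₁ l₂ x₁ x₂ p₁ p₂ →
      l₁ :* (x₁ :* p₂ :- x₂ :* p₁) := p₂ :* (l₁ :* x₁ :+ l₂ :* x₂) :- x₂ :* (l₁ :* p₁ :+ l₂ :* p₂)) refl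
    eliminate₂ : ∀ l₁ l₂ x₁ x₂ p₁ p₂ → l₂ * (x₁ * p₂ - x₂ * p₁) ≈ x₁ * (l₁ * p₁ + l₂ * p₂) - p₁ * (l₁ * x₁ + l₂ * x₂)
    eliminate₂ = solve 6 (λ l₁ l₂ x₁ x₂ p₁ p₂ →
      l₂ :* (x₁ :* p₂ :- x₂ :* p₁) := x₁ :* (l₁ :* p₁ :+ l₂ :* p₂) :- p₁ :* (l₁ :* x₁ :+ l₂ :* x₂)) refl

  proportional⇒Inc : ∀ {M P X} → NZ P → ¬ (P ∼ T) → x₁ X * x₂ P ≈ x₂ X * x₁ P → Inc T M → Inc P M → Inc X M
  proportional⇒Inc {M} {P} {X} P≢0 P≁T D T∈M P∈M = trans (dot-throughT X m₃≈0) X∈M′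
    where
    open V3 M using () renaming (x₁ to m₁; x₂ to m₂)
    open V3 P using () renaming (x₁ to p₁; x₂ to p₂)
    open V3 X using () renaming (x₁ to ξ₁; x₂ to ξ₂)
    m₃≈0 = trans (sym (dot-T M)) T∈M
    P∈M′ : m₁ * p₁ + m₂ * p₂ ≈ 0#
    P∈M′ = trans (sym (dot-throughT P m₃≈0)) P∈M
    D′ : ξ₁ * p₂ - ξ₂ * p₁ ≈ 0#
    D′ = x≈y⇒x∙y⁻¹≈ε D
    expand₁ : ∀ m₁ m₂ ξ₁ ξ₂ p₁ p₂ → p₁ * (m₁ * ξ₁ + m₂ * ξ₂) ≈ ξ₁ * (m₁ * p₁ + m₂ * p₂) - m₂ * (ξ₁ * p₂ - ξ₂ * p₁)
    expand₁ = solve 6 (λ m₁ m₂ ξ₁ ξ₂ p₁ p₂ →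
      p₁ :* (m₁ :* ξ₁ :+ m₂ :* ξ₂) := ξ₁ :* (m₁ :* p₁ :+ m₂ :* p₂) :- m₂ :* (ξ₁ :* p₂ :- ξ₂ :* p₁)) refl
    expand₂ : ∀ m₁ m₂ ξ₁ ξ₂ p₁ p₂ → p₂ * (m₁ * ξ₁ + m₂ * ξ₂) ≈ ξ₂ * (m₁ * p₁ + m₂ * p₂) + m₁ * (ξ₁ * p₂ - ξ₂ * p₁)
    expand₂ = solve 6 (λ m₁ m₂ ξ₁ ξ₂ p₁ p₂ →
      p₂ :* (m₁ :* ξ₁ :+ m₂ :* ξ₂) := ξ₂ :* (m₁ :* p₁ :+ m₂ :* p₂) :+ m₁ :* (ξ₁ :* p₂ :- ξ₂ :* p₁)) refl
    X∈M′ : m₁ * ξ₁ + m₂ * ξ₂ ≈ 0#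
    X∈M′ with p₁ ≟ 0#
    ... | no p₁≉0 = x*y≈0⇒y≈0 p₁≉0 (begin
      p₁ * (m₁ * ξ₁ + m₂ * ξ₂)                          ≈⟨ expand₁ m₁ m₂ ξ₁ ξ₂ p₁ p₂ ⟩
      ξ₁ * (m₁ * p₁ + m₂ * p₂) - m₂ * (ξ₁ * p₂ - ξ₂ * p₁) ≈⟨ a*u-b*v≈0 P∈M′ D′ ⟩
      0#                                                ∎)
    ... | yes p₁≈0 = x*y≈0⇒y≈0 p₂≉0 (begin
      p₂ * (m₁ * ξ₁ + m₂ * ξ₂)                          ≈⟨ expand₂ m₁ m₂ ξ₁ ξ₂ p₁ p₂ ⟩
      ξ₂ * (m₁ * p₁ + m₂ * p₂) + m₁ * (ξ₁ * p₂ - ξ₂ * p₁) ≈⟨ a*u+b*v≈0 P∈M′ D′ ⟩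
      0#                                                ∎)
      where p₂≉0 = λ p₂≈0 → P≁T (∼T P≢0 p₁≈0 p₂≈0)

  TP-unique : ∀ {P L M X} → NZ P → ¬ (P ∼ T) → NZ L → Inc T L → Inc P L → Inc X L → Inc T M → Inc P M → Inc X M
  TP-unique P≢0 P≁T L≢0 T∈L P∈L X∈L = proportional⇒Inc P≢0 P≁T (throughT-proportional L≢0 T∈L P∈L X∈L)

  ∼-Inc : ∀ {X Y L} → X ∼ Y → Inc X L → Inc Y L
  ∼-Inc {X} {Y} {L} (k , k≉0 , e₁ , e₂ , e₃) X∈L = x*y≈0⇒y≈0 k≉0 (begin
    k * dot L Y                                          ≈⟨ spread k (x₁ L) (x₂ L) (x₃ L) (x₁ Y) (x₂ Y) (x₃ Y) ⟩
    x₁ L * (k * x₁ Y) + x₂ L * (k * x₂ Y) + x₃ L * (k * x₃ Y) ≈⟨ dot-cong ≋-refl (e₁ , e₂ , e₃) ⟨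
    dot L X                                              ≈⟨ X∈L ⟩
    0#                                                   ∎)
    where
    spread : ∀ k l₁ l₂ l₃ y₁ y₂ y₃ → k * (l₁ * y₁ + l₂ * y₂ + l₃ * y₃) ≈ l₁ * (k * y₁) + l₂ * (k * y₂) + l₃ * (k * y₃)
    spread = solve 7 (λ k l₁ l₂ l₃ y₁ y₂ y₃ →
      k :* (l₁ :* y₁ :+ l₂ :* y₂ :+ l₃ :* y₃) := l₁ :* (k :* y₁) :+ l₂ :* (k :* y₂) :+ l₃ :* (k :* y₃)) refl

  throughT-e₂⇒x₁≈0 : ∀ {M X} → NZ M → Inc T M → Inc e₂ M → Inc X M → x₁ X ≈ 0#
  throughT-e₂⇒x₁≈0 {M} {X} M≢0 T∈M e₂∈M X∈M =
    x*y≈0⇒y≈0 (λ m₁≈0 → M≢0 (m₁≈0 , m₂≈0 , m₃≈0)) (trans (sym (dot-axis₁ _ X)) (Inc-cong ≋-refl (refl , m₂≈0 , m₃≈0) X∈M))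
    where
    m₂≈0 = trans (sym (dot-e₂ M)) e₂∈M
    m₃≈0 = trans (sym (dot-T M)) T∈M

  throughT-e₁⇒x₂≈0 : ∀ {M X} → NZ M → Inc T M → Inc e₁ M → Inc X M → x₂ X ≈ 0#
  throughT-e₁⇒x₂≈0 {M} {X} M≢0 T∈M e₁∈M X∈M =
    x*y≈0⇒y≈0 (λ m₂≈0 → M≢0 (m₁≈0 , m₂≈0 , m₃≈0)) (trans (sym (dot-axis₂ _ X)) (Inc-cong ≋-refl (m₁≈0 , refl , m₃≈0) X∈M))
    where
    m₁≈0 = trans (sym (dot-e₁ M)) e₁∈M
    m₃≈0 = trans (sym (dot-T M)) T∈M

  lift-projects : ∀ {X P s z} → NZ X → Inc X mT → s ≉ 0# → P ≋ ⟨ x₁ X * s , x₂ X * s , z ⟩ →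
                  NZ P × ¬ (P ∼ T) × ∃[ L ] (NZ L × Inc T L × Inc P L × Inc X L)
  lift-projects {X} {P} {s} {z} X≢0 X∈mT s≉0 P≋ = P≢0 , P≁T , L , L≢0 , dot-T L , P∈L , X∈L
    where
    L = ⟨ x₂ X , - x₁ X , 0# ⟩

    x₁,x₂≉0 : x₁ P ≈ 0# → x₂ P ≈ 0# → ⊥
    x₁,x₂≉0 p₁≈0 p₂≈0 = X≢0 (x*y≈0⇒x≈0 s≉0 (trans (sym (proj₁ P≋)) p₁≈0) ,
                             x*y≈0⇒x≈0 s≉0 (trans (sym (proj₁ (proj₂ P≋))) p₂≈0) , Inc-mT X∈mT)

    P≢0 : NZ P
    P≢0 (p₁≈0 , p₂≈0 , _) = x₁,x₂≉0 p₁≈0 p₂≈0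

    P≁T : ¬ (P ∼ T)
    P≁T (k , _ , e₁ , e₂ , _) = x₁,x₂≉0 (trans e₁ (zeroʳ k)) (trans e₂ (zeroʳ k))

    L≢0 : NZ L
    L≢0 (x₂≈0 , -x₁≈0 , _) = X≢0 (-‿injective (trans -x₁≈0 (sym -0#≈0#)) , x₂≈0 , Inc-mT X∈mT)

    P∈L : Inc P L
    P∈L = trans (dot-cong ≋-refl P≋) (solve 4 (λ x₁ x₂ s z →
      x₂ :* (x₁ :* s) :+ (:- x₁) :* (x₂ :* s) :+ :0 :* z := :0) refl (x₁ X) (x₂ X) s z)

    X∈L : Inc X L
    X∈L = solve 3 (λ x₁ x₂ x₃ → x₂ :* x₁ :+ (:- x₁) :* x₂ :+ :0 :* x₃ := :0) refl (x₁ X) (x₂ X) (x₃ X)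

module FigProjection {c ℓ} (R : CommutativeRing c ℓ) {q} (q-primePower : IsPrimePower q)
                     (isField : IsField R) (size : HasSize R (q ℕ.^ 3)) where
  open CommutativeRing R
  open Field R isField
  open FiniteField R isField size using (_≟_)
  open CubicExtension R q-primePower isField size
  open PG R q
  open PlaneCoordinates R isField _≟_ q
  open IntegerCoefficientSolver R using (solve; _:+_; _:*_; :-_; _:-_; _:=_; :0)
  open import Algebra.Properties.Ring ring using (x∙y⁻¹≈ε⇒x≈y; -‿injective; -0#≈0#)
  open import Relation.Binary.Reasoning.Setoid setoid

  φ-cong : ∀ {u v} → u ≋ v → φ u ≋ φ v
  φ-cong (e₁ , e₂ , e₃) = σ-cong e₃ , σ-cong e₁ , σ-cong e₂

  φ³≋id : ∀ v → φ (φ (φ v)) ≋ v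
  φ³≋id v = σ³≈id (x₁ v) , σ³≈id (x₂ v) , σ³≈id (x₃ v)

  dot-φ : ∀ L P → dot (φ L) (φ P) ≈ σ (dot L P)
  dot-φ L P = begin
    σ l₃ * σ p₃ + σ l₁ * σ p₁ + σ l₂ * σ p₂          ≈⟨ rotate (σ l₃ * σ p₃) (σ l₁ * σ p₁) (σ l₂ * σ p₂) ⟩
    σ l₁ * σ p₁ + σ l₂ * σ p₂ + σ l₃ * σ p₃          ≈⟨ +-cong (+-cong (σ-homo-* l₁ p₁) (σ-homo-* l₂ p₂)) (σ-homo-* l₃ p₃) ⟨
    σ (l₁ * p₁) + σ (l₂ * p₂) + σ (l₃ * p₃)         ≈⟨ trans (σ-homo-+ _ (l₃ * p₃)) (+-congʳ (σ-homo-+ (l₁ * p₁) (l₂ * p₂))) ⟨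
    σ (dot L P)                                    ∎
    where
    open V3 L using () renaming (x₁ to l₁; x₂ to l₂; x₃ to l₃)
    open V3 P using () renaming (x₁ to p₁; x₂ to p₂; x₃ to p₃)
    rotate : ∀ a b c → a + b + c ≈ b + c + a
    rotate = solve 3 (λ a b c → a :+ b :+ c := b :+ c :+ a) refl

  Inc-φ : ∀ {P L} → Inc P L → Inc (φ P) (φ L)
  Inc-φ {P} {L} P∈L = trans (dot-φ L P) (trans (σ-cong P∈L) σ-0)

  Inc-fixed-φ : ∀ {W L} → φ W ≋ W → Inc W L → Inc W (φ L)
  Inc-fixed-φ φW≋W W∈L = Inc-cong φW≋W ≋-refl (Inc-φ W∈L)

  Inc-fixed-φ⁻¹ : ∀ {W L} → φ W ≋ W → Inc W (φ L) → Inc W L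
  Inc-fixed-φ⁻¹ {L = L} φW≋W W∈φL = Inc-cong ≋-refl (φ³≋id L) (Inc-fixed-φ φW≋W (Inc-fixed-φ φW≋W W∈φL))

  fixedPoint⇒Concurrent : ∀ {W l} → NZ W → φ W ≋ W → Inc W l → Concurrent l (φ l) (φ² l)
  fixedPoint⇒Concurrent {W} W≢0 φW≋W W∈l =
    W , W≢0 , W∈l , Inc-fixed-φ φW≋W W∈l , Inc-fixed-φ φW≋W (Inc-fixed-φ φW≋W W∈l)

  φT≋e₁ : φ T ≋ e₁
  φT≋e₁ = σ-1 , σ-0 , σ-0

  φ²T≋e₂ : φ² T ≋ e₂
  φ²T≋e₂ = ≋-trans (φ-cong φT≋e₁) (σ-0 , σ-1 , σ-0)

  ∼φT⇒x₂≈0 : ∀ {X} → X ∼ φ T → x₂ X ≈ 0#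
  ∼φT⇒x₂≈0 (k , _ , _ , e₂ , _) = trans e₂ (trans (*-congˡ σ-0) (zeroʳ k))

  ∼φ²T⇒x₁≈0 : ∀ {X} → X ∼ φ² T → x₁ X ≈ 0#
  ∼φ²T⇒x₁≈0 (k , _ , e₁ , _ , _) = trans e₁ (trans (*-congˡ (σ≈0 σ-0)) (zeroʳ k))

  x₂≈0⇒∼φT : ∀ {X} → NZ X → Inc X mT → x₂ X ≈ 0# → X ∼ φ T
  x₂≈0⇒∼φT {X} X≢0 X∈mT x₂≈0 = x₁ X , (λ x₁≈0 → X≢0 (x₁≈0 , x₂≈0 , Inc-mT X∈mT)) ,
    sym (trans (*-congˡ σ-1) (*-identityʳ _)) , trans x₂≈0 (sym (trans (*-congˡ σ-0) (zeroʳ _))) ,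
    trans (Inc-mT X∈mT) (sym (trans (*-congˡ σ-0) (zeroʳ _)))

  x₁≈0⇒∼φ²T : ∀ {X} → NZ X → Inc X mT → x₁ X ≈ 0# → X ∼ φ² T
  x₁≈0⇒∼φ²T {X} X≢0 X∈mT x₁≈0 = x₂ X , (λ x₂≈0 → X≢0 (x₁≈0 , x₂≈0 , Inc-mT X∈mT)) ,
    trans x₁≈0 (sym (trans (*-congˡ (σ≈0 σ-0)) (zeroʳ _))) , sym (trans (*-congˡ (trans (σ-cong σ-1) σ-1)) (*-identityʳ _)) ,
    trans (Inc-mT X∈mT) (sym (trans (*-congˡ (σ≈0 σ-0)) (zeroʳ _)))

  -- For X ∼ (a, σ a, 0) the witness is (a, σ a, σ² a).
  S₁⇒fixedPoint : ∀ {X M} → S₁ X → Inc X M → x₃ M ≈ 0# → ∃[ W ] (NZ W × φ W ≋ W × Inc W M)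
  S₁⇒fixedPoint {X} {M} (a , a≉0 , X∼a) X∈M m₃≈0 =
    ⟨ a , σ a , σ (σ a) ⟩ , (λ (a≈0 , _) → a≉0 a≈0) , (σ³≈id a , refl , refl) ,
    trans (dot-throughT _ m₃≈0) (trans (sym (dot-throughT _ m₃≈0)) (∼-Inc X∼a X∈M))

  S₁⇒x₁≉0 : ∀ {X} → S₁ X → x₁ X ≉ 0#
  S₁⇒x₁≉0 (a , a≉0 , k , k≉0 , e₁ , _) x₁≈0 = x*y≉0 k≉0 a≉0 (trans (sym e₁) x₁≈0)

  S₁⇒x₂≉0 : ∀ {X} → S₁ X → x₂ X ≉ 0#
  S₁⇒x₂≉0 (a , a≉0 , k , k≉0 , _ , e₂ , _) x₂≈0 = x*y≉0 k≉0 (σ-≉0 a≉0) (trans (sym e₂) x₂≈0)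

  equalNorms⇒S₁ : ∀ {X} → NZ X → Inc X mT → norm (x₁ X) ≈ norm (x₂ X) → S₁ X
  equalNorms⇒S₁ {X} X≢0 X∈mT N₁≈N₂ =
    let a , a≉0 , k , k≉0 , x₁≈ka , x₂≈kσa = equalNorms⇒proportional x₁≉0 N₁≈N₂ in
    a , a≉0 , k , k≉0 , x₁≈ka , x₂≈kσa , trans (Inc-mT X∈mT) (sym (zeroʳ k))
    where
    x₁≉0 : x₁ X ≉ 0#
    x₁≉0 x₁≈0 = X≢0 (x₁≈0 , norm≈0⇒x≈0 (trans (sym N₁≈N₂) (trans (norm-cong x₁≈0) norm-0)) , Inc-mT X∈mT)

  ¬S₁⇒norms≉ : ∀ {X} → NZ X → Inc X mT → ¬ S₁ X → norm (x₂ X) - norm (x₁ X) ≉ 0#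
  ¬S₁⇒norms≉ X≢0 X∈mT X∉S₁ difference≈0 = X∉S₁ (equalNorms⇒S₁ X≢0 X∈mT (sym (x∙y⁻¹≈ε⇒x≈y _ _ difference≈0)))

  μ : V3 → V3
  μ l = cross (φ l) (φ² l)

  -- The only line through φ T and φ² T is m_T, and μ m_T = T.
  μ-of-mT : ∀ {l P} → NZ l → x₁ l ≈ 0# → x₂ l ≈ 0# → NZ P → Inc P (φ l) → Inc P (φ² l) → P ∼ T
  μ-of-mT {l} {P} l≢0 l₁≈0 l₂≈0 P≢0 P∈φl P∈φ²l = ∼T P≢0
    (x*y≈0⇒y≈0 (σ-≉0 l₃≉0) (trans (sym (dot-axis₁ _ P)) (Inc-cong ≋-refl (refl , σ≈0 l₁≈0 , σ≈0 l₂≈0) P∈φl)))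
    (x*y≈0⇒y≈0 (σ-≉0 (σ-≉0 l₃≉0)) (trans (sym (dot-axis₂ _ P)) (Inc-cong ≋-refl (σ≈0 (σ≈0 l₂≈0) , refl , σ≈0 (σ≈0 l₁≈0)) P∈φ²l)))
    where
    l₃≉0 = λ l₃≈0 → l≢0 (l₁≈0 , l₂≈0 , l₃≈0)

  μ-projects : ∀ {U X l s z} → NZ X → Inc X mT → NZ l → Inc U l → det l (φ l) (φ² l) ≉ 0# → s ≉ 0# →
               μ l ≋ ⟨ x₁ X * s , x₂ X * s , z ⟩ → Pr (FigMinusT U) X
  μ-projects {l = l} X≢0 X∈mT l≢0 U∈l det≉0 s≉0 μl≋ =
    let μl≢0 , μl≁T , L = lift-projects X≢0 X∈mT s≉0 μl≋ in
    μ l , μl≢0 , (inj₂ (l , l≢0 , det≉0⇒¬Concurrent det≉0 , U∈l , cross-onˡ (φ l) (φ² l) , cross-onʳ (φ l) (φ² l)) , μl≁T) ,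
    X∈mT , L

  Pr-Fig-φT⇒ : ∀ X → NZ X → Pr (FigMinusT (φ T)) X → Inc X mT × ¬ S₁ X × ¬ (X ∼ φ T)
  Pr-Fig-φT⇒ X X≢0 (P , P≢0 , (P∈Fig , P≁T) , X∈mT , L , L≢0 , T∈L , P∈L , X∈L) = X∈mT , excluded P∈Fig
    where
    onTP : ∀ {M} → Inc T M → Inc P M → Inc X M
    onTP = TP-unique P≢0 P≁T L≢0 T∈L P∈L X∈L

    excluded : Fig (φ T) P → ¬ S₁ X × ¬ (X ∼ φ T)
    excluded (inj₁ (_ , M , M≢0 , φ²T∈M , φ³T∈M , P∈M)) =
      (λ X∈S₁ → S₁⇒x₁≉0 X∈S₁ x₁≈0) , (λ X∼φT → X≢0 (x₁≈0 , ∼φT⇒x₂≈0 X∼φT , Inc-mT X∈mT))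
      where
      T∈M = Inc-cong (φ³≋id T) ≋-refl φ³T∈M
      x₁≈0 = throughT-e₂⇒x₁≈0 M≢0 T∈M (Inc-cong φ²T≋e₂ ≋-refl φ²T∈M) (onTP T∈M P∈M)
    excluded (inj₂ (l , l≢0 , l-typeIII , φT∈l , P∈φl , P∈φ²l)) = X∉S₁ , X≁φT
      where
      l₁≈0 : x₁ l ≈ 0#
      l₁≈0 = trans (sym (dot-e₁ l)) (Inc-cong φT≋e₁ ≋-refl φT∈l)

      X∈φ²l : Inc X (φ² l)
      X∈φ²l = onTP (trans (dot-T (φ² l)) (σ≈0 (σ≈0 l₁≈0))) P∈φ²l

      X∉S₁ : ¬ S₁ X
      X∉S₁ X∈S₁ = let W , W≢0 , φW≋W , W∈φ²l = S₁⇒fixedPoint X∈S₁ X∈φ²l (σ≈0 (σ≈0 l₁≈0)) in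
        l-typeIII (fixedPoint⇒Concurrent W≢0 φW≋W (Inc-fixed-φ⁻¹ φW≋W (Inc-fixed-φ⁻¹ φW≋W W∈φ²l)))

      X≁φT : ¬ (X ∼ φ T)
      X≁φT X∼φT = P≁T (μ-of-mT l≢0 l₁≈0 l₂≈0 P≢0 P∈φl P∈φ²l)
        where
        l₂≈0 = σx≈0⇒x≈0 (σx≈0⇒x≈0 (trans (sym (dot-e₁ (φ² l))) (Inc-cong φT≋e₁ ≋-refl (∼-Inc X∼φT X∈φ²l))))

  -- l = [0, σ x₂, -σ x₁] passes through φ T, and φ² l = [x₂, -x₁, 0] is the line TX.
  ⇒Pr-Fig-φT : ∀ X → NZ X → Inc X mT × ¬ S₁ X × ¬ (X ∼ φ T) → Pr (FigMinusT (φ T)) X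
  ⇒Pr-Fig-φT X X≢0 (X∈mT , X∉S₁ , X≁φT) = μ-projects X≢0 X∈mT l≢0 φT∈l det≉0 (σ-≉0 (σ-≉0 x₂≉0)) μl≋
    where
    open V3 X using () renaming (x₁ to ξ₁; x₂ to ξ₂)
    x₂≉0 : ξ₂ ≉ 0#
    x₂≉0 x₂≈0 = X≁φT (x₂≈0⇒∼φT X≢0 X∈mT x₂≈0)

    l = ⟨ 0# , σ ξ₂ , σ (- ξ₁) ⟩

    l≢0 : NZ l
    l≢0 (_ , σx₂≈0 , _) = x₂≉0 (σx≈0⇒x≈0 σx₂≈0)

    φT∈l : Inc (φ T) l
    φT∈l = Inc-cong (≋-sym φT≋e₁) ≋-refl (dot-e₁ l)

    l≋ : l ≋ ⟨ 0# , σ ξ₂ , - σ ξ₁ ⟩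
    l≋ = refl , refl , σ-homo-neg ξ₁

    φl≋ : φ l ≋ ⟨ - σ (σ ξ₁) , 0# , σ (σ ξ₂) ⟩
    φl≋ = trans (σ-cong (σ-homo-neg ξ₁)) (σ-homo-neg (σ ξ₁)) , σ-0 , refl

    φ²l≋ : φ² l ≋ ⟨ ξ₂ , - ξ₁ , 0# ⟩
    φ²l≋ = σ³≈id ξ₂ , σ³≈id (- ξ₁) , σ≈0 σ-0

    μl≋ : μ l ≋ ⟨ ξ₁ * σ (σ ξ₂) , ξ₂ * σ (σ ξ₂) , ξ₁ * σ (σ ξ₁) ⟩
    μl≋ = ≋-trans (cross-cong φl≋ φ²l≋)
      ( solve 4 (λ a b ξ₁ ξ₂ → :0 :* :0 :- b :* (:- ξ₁) := ξ₁ :* b) refl (σ (σ ξ₁)) (σ (σ ξ₂)) ξ₁ ξ₂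
      , solve 4 (λ a b ξ₁ ξ₂ → b :* ξ₂ :- (:- a) :* :0 := ξ₂ :* b) refl (σ (σ ξ₁)) (σ (σ ξ₂)) ξ₁ ξ₂
      , solve 4 (λ a b ξ₁ ξ₂ → (:- a) :* (:- ξ₁) :- :0 :* ξ₂ := ξ₁ :* a) refl (σ (σ ξ₁)) (σ (σ ξ₂)) ξ₁ ξ₂ )

    det≉0 : det l (φ l) (φ² l) ≉ 0#
    det≉0 det≈0 = ¬S₁⇒norms≉ X≢0 X∈mT X∉S₁ (begin
      norm ξ₂ - norm ξ₁  ≈⟨ solve 6 (λ ξ₁ σξ₁ σ²ξ₁ ξ₂ σξ₂ σ²ξ₂ →
                              ξ₂ :* σξ₂ :* σ²ξ₂ :- ξ₁ :* σξ₁ :* σ²ξ₁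
                                := :0 :* (ξ₁ :* σ²ξ₂) :+ σξ₂ :* (ξ₂ :* σ²ξ₂) :+ (:- σξ₁) :* (ξ₁ :* σ²ξ₁)) refl
                              ξ₁ (σ ξ₁) (σ (σ ξ₁)) ξ₂ (σ ξ₂) (σ (σ ξ₂)) ⟩
      dot ⟨ 0# , σ ξ₂ , - σ ξ₁ ⟩ ⟨ ξ₁ * σ (σ ξ₂) , ξ₂ * σ (σ ξ₂) , ξ₁ * σ (σ ξ₁) ⟩
                         ≈⟨ dot-cong l≋ μl≋ ⟨
      det l (φ l) (φ² l) ≈⟨ det≈0 ⟩
      0#                 ∎)

  Pr-Fig-φT : Part1
  Pr-Fig-φT X X≢0 = mk⇔ (Pr-Fig-φT⇒ X X≢0) (⇒Pr-Fig-φT X X≢0)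

  Pr-Fig-φ²T⇒ : ∀ X → NZ X → Pr (FigMinusT (φ² T)) X → Inc X mT × ¬ S₁ X × ¬ (X ∼ φ² T)
  Pr-Fig-φ²T⇒ X X≢0 (P , P≢0 , (P∈Fig , P≁T) , X∈mT , L , L≢0 , T∈L , P∈L , X∈L) = X∈mT , excluded P∈Fig
    where
    onTP : ∀ {M} → Inc T M → Inc P M → Inc X M
    onTP = TP-unique P≢0 P≁T L≢0 T∈L P∈L X∈L

    excluded : Fig (φ² T) P → ¬ S₁ X × ¬ (X ∼ φ² T)
    excluded (inj₁ (_ , M , M≢0 , φ³T∈M , φ⁴T∈M , P∈M)) =
      (λ X∈S₁ → S₁⇒x₂≉0 X∈S₁ x₂≈0) , (λ X∼φ²T → X≢0 (∼φ²T⇒x₁≈0 X∼φ²T , x₂≈0 , Inc-mT X∈mT))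
      where
      T∈M = Inc-cong (φ³≋id T) ≋-refl φ³T∈M
      x₂≈0 = throughT-e₁⇒x₂≈0 M≢0 T∈M (Inc-cong (≋-trans (φ³≋id (φ T)) φT≋e₁) ≋-refl φ⁴T∈M) (onTP T∈M P∈M)
    excluded (inj₂ (l , l≢0 , l-typeIII , φ²T∈l , P∈φl , P∈φ²l)) = X∉S₁ , X≁φ²T
      where
      l₂≈0 : x₂ l ≈ 0#
      l₂≈0 = trans (sym (dot-e₂ l)) (Inc-cong φ²T≋e₂ ≋-refl φ²T∈l)

      X∈φl : Inc X (φ l)
      X∈φl = onTP (trans (dot-T (φ l)) (σ≈0 l₂≈0)) P∈φl

      X∉S₁ : ¬ S₁ X
      X∉S₁ X∈S₁ = let W , W≢0 , φW≋W , W∈φl = S₁⇒fixedPoint X∈S₁ X∈φl (σ≈0 l₂≈0) in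
        l-typeIII (fixedPoint⇒Concurrent W≢0 φW≋W (Inc-fixed-φ⁻¹ φW≋W W∈φl))

      X≁φ²T : ¬ (X ∼ φ² T)
      X≁φ²T X∼φ²T = P≁T (μ-of-mT l≢0 l₁≈0 l₂≈0 P≢0 P∈φl P∈φ²l)
        where
        l₁≈0 = σx≈0⇒x≈0 (trans (sym (dot-e₂ (φ l))) (Inc-cong φ²T≋e₂ ≋-refl (∼-Inc X∼φ²T X∈φl)))

  -- l = [-σ² x₁, 0, σ² x₂] passes through φ² T, and φ l = [x₂, -x₁, 0] is the line TX.
  ⇒Pr-Fig-φ²T : ∀ X → NZ X → Inc X mT × ¬ S₁ X × ¬ (X ∼ φ² T) → Pr (FigMinusT (φ² T)) X
  ⇒Pr-Fig-φ²T X X≢0 (X∈mT , X∉S₁ , X≁φ²T) = μ-projects X≢0 X∈mT l≢0 φ²T∈l det≉0 (σ-≉0 x₁≉0) μl≋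
    where
    open V3 X using () renaming (x₁ to ξ₁; x₂ to ξ₂)
    x₁≉0 : ξ₁ ≉ 0#
    x₁≉0 x₁≈0 = X≁φ²T (x₁≈0⇒∼φ²T X≢0 X∈mT x₁≈0)

    l = ⟨ σ (σ (- ξ₁)) , 0# , σ (σ ξ₂) ⟩

    l≋ : l ≋ ⟨ - σ (σ ξ₁) , 0# , σ (σ ξ₂) ⟩
    l≋ = trans (σ-cong (σ-homo-neg ξ₁)) (σ-homo-neg (σ ξ₁)) , refl , refl

    l≢0 : NZ l
    l≢0 (σ²[-x₁]≈0 , _) = x₁≉0 (-‿injective (trans (σx≈0⇒x≈0 (σx≈0⇒x≈0 σ²[-x₁]≈0)) (sym -0#≈0#)))

    φ²T∈l : Inc (φ² T) l
    φ²T∈l = Inc-cong (≋-sym φ²T≋e₂) ≋-refl (dot-e₂ l)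

    φl≋ : φ l ≋ ⟨ ξ₂ , - ξ₁ , 0# ⟩
    φl≋ = σ³≈id ξ₂ , σ³≈id (- ξ₁) , σ-0

    φ²l≋ : φ² l ≋ ⟨ 0# , σ ξ₂ , - σ ξ₁ ⟩
    φ²l≋ = σ≈0 σ-0 , σ-cong (σ³≈id ξ₂) , trans (σ-cong (σ³≈id (- ξ₁))) (σ-homo-neg ξ₁)

    μl≋ : μ l ≋ ⟨ ξ₁ * σ ξ₁ , ξ₂ * σ ξ₁ , ξ₂ * σ ξ₂ ⟩
    μl≋ = ≋-trans (cross-cong φl≋ φ²l≋)
      ( solve 4 (λ a b ξ₁ ξ₂ → (:- ξ₁) :* (:- a) :- :0 :* b := ξ₁ :* a) refl (σ ξ₁) (σ ξ₂) ξ₁ ξ₂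
      , solve 4 (λ a b ξ₁ ξ₂ → :0 :* :0 :- ξ₂ :* (:- a) := ξ₂ :* a) refl (σ ξ₁) (σ ξ₂) ξ₁ ξ₂
      , solve 4 (λ a b ξ₁ ξ₂ → ξ₂ :* b :- (:- ξ₁) :* :0 := ξ₂ :* b) refl (σ ξ₁) (σ ξ₂) ξ₁ ξ₂ )

    det≉0 : det l (φ l) (φ² l) ≉ 0#
    det≉0 det≈0 = ¬S₁⇒norms≉ X≢0 X∈mT X∉S₁ (begin
      norm ξ₂ - norm ξ₁  ≈⟨ solve 6 (λ ξ₁ σξ₁ σ²ξ₁ ξ₂ σξ₂ σ²ξ₂ →
                              ξ₂ :* σξ₂ :* σ²ξ₂ :- ξ₁ :* σξ₁ :* σ²ξ₁
                                := (:- σ²ξ₁) :* (ξ₁ :* σξ₁) :+ :0 :* (ξ₂ :* σξ₁) :+ σ²ξ₂ :* (ξ₂ :* σξ₂)) refl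
                              ξ₁ (σ ξ₁) (σ (σ ξ₁)) ξ₂ (σ ξ₂) (σ (σ ξ₂)) ⟩
      dot ⟨ - σ (σ ξ₁) , 0# , σ (σ ξ₂) ⟩ ⟨ ξ₁ * σ ξ₁ , ξ₂ * σ ξ₁ , ξ₂ * σ ξ₂ ⟩
                         ≈⟨ dot-cong l≋ μl≋ ⟨
      det l (φ l) (φ² l) ≈⟨ det≈0 ⟩
      0#                 ∎)

  Pr-Fig-φ²T : Part2
  Pr-Fig-φ²T X X≢0 = mk⇔ (Pr-Fig-φ²T⇒ X X≢0) (⇒Pr-Fig-φ²T X X≢0)

-- ℕ's _^_ for the statement; above, _^_ is exponentiation in R.
open import Data.Nat using (_^_)

theorem6p3 : ∀ {c ℓ : Level} (R : CommutativeRing c ℓ) (q : ℕ)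
    → IsPrimePower q → IsField R → HasSize R (q ^ 3)
    → PG.Part1 R q × PG.Part2 R q
theorem6p3 R q q-primePower isField size = Pr-Fig-φT , Pr-Fig-φ²T
  where open FigProjection R q-primePower isField size
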